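{- Let $n,k\ge1$, $\sigma\in\mathfrak{S}_n$, let $r,s\in[n]$ with $|r-s|>1$, and suppose $\sigma_r=\ell$ and $\sigma_s=\ell+1$. Let $\tau\in\mathfrak{S}_n$ be obtained from $\sigma$ by switching these two entries, i.e. $\tau_r=\ell+1$, $\tau_s=\ell$, and $\tau_i=\sigma_i$ for $i\notin\{r,s\}$. Then the maps $f_{rs},F_{rs}:\mathrm{SYT}(k^n)\to\mathrm{SYT}(k^n)$ defined below are bijections, and for all $T\in\mathrm{SYT}(k^n)$, $$\operatorname{des}_\sigma(T)=\operatorname{des}_\tau(f_{rs}(T)),\qquad \operatorname{plat}(T)=\operatorname{plat}(f_{rs}(T)),\qquad \operatorname{Des}_\sigma(T)=\operatorname{Des}_\tau(F_{rs}(T)).$$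
   Context: $\mathrm{SYT}(k^n)$ is the set of standard Young tableaux of rectangular shape with $n$ rows and $k$ columns filled with $1,\dots,kn$. For $T\in\mathrm{SYT}(k^n)$, $\operatorname{row}(i)$ is the index (top row $=1$) of the row containing $i$. For $\sigma\in\mathfrak{S}_n$, $\operatorname{Des}_\sigma(T)=\{i\in[kn-1]:\sigma_{\operatorname{row}(i)}>\sigma_{\operatorname{row}(i+1)}\}$, $\operatorname{des}_\sigma(T)=|\operatorname{Des}_\sigma(T)|$, and $\operatorname{plat}(T)=|\{i\in[kn-1]:\operatorname{row}(i)=\operatorname{row}(i+1)\}|$. The tableau word of $T$ is $w_T=\operatorname{row}(1)\operatorname{row}(2)\cdots\operatorname{row}(kn)$; $T$ is determined by $w_T$, and a word with $k$ copies of each element of $[n]$ is a tableau word iff in every prefix the number of copies of $j$ is at least the number of copies of $j+1$ for all $j$. Definition of $f_{rs}(T)$: the tableau word of $f_{rs}(T)$ is obtained from $w_T$ by replacing each maximal block $B$ of consecutive letters all lying in $\{r,s\}$ by $B'$, where: (1) if $B$ starts and ends with the same letter, $B'=B$; (2) if $B=r^{a_1}s^{b_1}\cdots r^{a_j}s^{b_j}$ with $j\ge1$, all $a_i,b_i\ge1$, then $B'=s^{b_1}r^{a_1}\cdots s^{b_j}r^{a_j}$, and if $B=s^{b_1}r^{a_1}\cdots s^{b_j}r^{a_j}$ then $B'=r^{a_1}s^{b_1}\cdots r^{a_j}s^{b_j}$. Definition of $F_{rs}(T)$: the tableau word of $F_{rs}(T)$ is obtained from $w_T$ by replacing each such maximal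 block $B$ by $B''$, where: view $B$ as a cyclic word (its last letter followed by its first) and split it into subblocks at each position where an $s$ is immediately followed by an $r$ (so a subblock may straddle from the end of $B$ to its beginning); each subblock has the form $r^as^b$ with $a,b\ge1$, and is replaced by $s^br^a$ occupying the same positions, keeping the splitting points; $B''$ is the result. (Example: $B=srrsssrr$ splits as $s/rrsss/rr$ and becomes $B''=r/sssrr/sr$.) -}

module Defs where

open import Data.Nat using (ℕ; zero; suc; _≤_; _∸_)
open import Data.Fin using (Fin; toℕ; _≟_; _<?_)
open import Data.Bool using (Bool; true; false; if_then_else_; _∧_; _∨_)
open import Data.List using (List; []; _∷_; _++_; [_]; length; take; drop; concat)
open import Data.Maybe using (Maybe; just; nothing)
open import Data.Product using (_×_)
open import Relation.Nullary.Decidable using (isYes)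
open import Relation.Binary.PropositionalEquality using (_≡_)

-- A tableau T ∈ SYT(k^n) is represented by its tableau word
-- w_T = row(1) row(2) ⋯ row(kn), rows indexed by Fin n (row 0 = top row).

module _ {n : ℕ} where

  _==_ : Fin n → Fin n → Bool
  a == b = isYes (a ≟ b)

  count : Fin n → List (Fin n) → ℕ
  count j []      = 0
  count j (x ∷ w) = if j == x then suc (count j w) else count j w

IsTabWord : (n k : ℕ) → List (Fin n) → Set
IsTabWord n k w =
  ((j : Fin n) → count j w ≡ k) ×
  ((m : ℕ) (j j′ : Fin n) → toℕ j′ ≡ suc (toℕ j) →
     count j′ (take m w) ≤ count j (take m w))

module _ {n : ℕ} where

  -- Des_σ(T) as the increasing list of positions i ∈ [kn-1] (1-based) with
  -- σ(row i) > σ(row (i+1)).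
  desPos : (Fin n → Fin n) → ℕ → List (Fin n) → List ℕ
  desPos σ i (a ∷ b ∷ w) =
    if isYes (σ b <? σ a) then i ∷ desPos σ (suc i) (b ∷ w)
                          else desPos σ (suc i) (b ∷ w)
  desPos σ i _ = []

  Des : (Fin n → Fin n) → List (Fin n) → List ℕ
  Des σ w = desPos σ 1 w

  des : (Fin n → Fin n) → List (Fin n) → ℕ
  des σ w = length (Des σ w)

  plat : List (Fin n) → ℕ
  plat (a ∷ b ∷ w) = if a == b then suc (plat (b ∷ w)) else plat (b ∷ w)
  plat _ = 0

  consRun : Fin n → List (List (Fin n)) → List (List (Fin n))
  consRun x ((y ∷ ys) ∷ rs) =
    if x == y then (x ∷ y ∷ ys) ∷ rs else (x ∷ []) ∷ (y ∷ ys) ∷ rs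
  consRun x rs = (x ∷ []) ∷ rs

  runs : List (Fin n) → List (List (Fin n))
  runs []      = []
  runs (x ∷ w) = consRun x (runs w)

  swapPairs : {A : Set} → List A → List A
  swapPairs (x ∷ y ∷ t) = y ∷ x ∷ swapPairs t
  swapPairs t = t

  lastOf : Fin n → List (Fin n) → Fin n
  lastOf x []      = x
  lastOf x (y ∷ w) = lastOf y w

  -- Block rule for f_rs: B ↦ B if B starts and ends with the same letter,
  -- otherwise r^a₁s^b₁⋯r^aⱼs^bⱼ ↦ s^b₁r^a₁⋯s^bⱼr^aⱼ (resp. with r,s exchanged),
  -- i.e. the runs are swapped in consecutive pairs.
  fBlock : List (Fin n) → List (Fin n)
  fBlock []      = []
  fBlock (x ∷ w) =
    if x == lastOf x w then x ∷ w else concat (swapPairs (runs (x ∷ w)))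

  rotate : ℕ → List (Fin n) → List (Fin n)
  rotate i B = drop i B ++ take i B

  module _ (r s : Fin n) where

    inRS : Fin n → Bool
    inRS x = (x == r) ∨ (x == s)

    firstSR : ℕ → List (Fin n) → Maybe ℕ
    firstSR j (a ∷ b ∷ w) =
      if (a == s) ∧ (b == r) then just (suc j) else firstSR (suc j) (b ∷ w)
    firstSR j _ = nothing

    -- a position at which the cyclic word B can be cut at an "s followed by r"
    cutPoint : List (Fin n) → Maybe ℕ
    cutPoint []      = nothing
    cutPoint (x ∷ w) =
      if (x == r) ∧ (lastOf x w == s) then just 0 else firstSR 0 (x ∷ w)

    -- Block rule for F_rs: rotate the cyclic word B so that it begins at a
    -- split point; it is then r^a₁s^b₁⋯r^aⱼs^bⱼ with subblocks r^aᵢs^bᵢ;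
    -- replace each by s^bᵢr^aᵢ and rotate back (same positions).
    -- If B has no split point (B uses only one letter), B is unchanged.
    FBlock : List (Fin n) → List (Fin n)
    FBlock B with cutPoint B
    ... | nothing = B
    ... | just i  =
      rotate (length B ∸ i) (concat (swapPairs (runs (rotate i B))))

    -- replace each maximal block of consecutive letters in {r,s} using g;
    -- acc holds the current (unfinished) block.
    blockMap : (List (Fin n) → List (Fin n)) →
               List (Fin n) → List (Fin n) → List (Fin n)
    blockMap g acc []      = g acc
    blockMap g acc (x ∷ w) =
      if inRS x then blockMap g (acc ++ [ x ]) w
                else g acc ++ x ∷ blockMap g [] w

    f : List (Fin n) → List (Fin n)
    f = blockMap fBlock []

    F : List (Fin n) → List (Fin n)
    F = blockMap FBlock []

IsSYTBijection : (n k : ℕ) → (List (Fin n) → List (Fin n)) → Set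
IsSYTBijection n k φ =
  ((w : List (Fin n)) → IsTabWord n k w → IsTabWord n k (φ w)) ×
  ((w v : List (Fin n)) → IsTabWord n k w → IsTabWord n k v →
     φ w ≡ φ v → w ≡ v) ×
  ((v : List (Fin n)) → IsTabWord n k v →
     Data.Product.Σ (List (Fin n)) (λ w → IsTabWord n k w × φ w ≡ v))

module Submission where

-- Des_σ, des_σ and plat only depend on the sequence of Boolean comparisons of adjacent letters of the
-- tableau word. As σ r and σ s are consecutive values and τ agrees with σ elsewhere, a letter outside
-- {r,s} compares alike with r and with s, under σ and under τ, so only comparisons inside a maximal
-- {r,s}-block can change. Inside a block, a run pair rᵃsᵇ followed by r has a single σ-descent, at its
-- end, and the swapped pair sᵇrᵃ followed by s has a single τ-descent, at the same place. F_rs cuts the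
-- block cyclically into such pairs and so preserves Des exactly. f_rs may instead pair the runs as sᵇrᵃ,
-- or leave alone a block with equal end letters (which has as many steps r → s as s → r), so it only
-- preserves the numbers of descents and of plateaux. Both maps only permute letters within blocks,
-- which keeps the ballot condition because rows r and s are not adjacent; f_rs is an involution and
-- F_sr inverts F_rs.

open import Defs
open import Data.Bool using (Bool; true; false; if_then_else_; _∧_)
open import Data.Bool.Properties using (∨-comm; ∨-zeroʳ; ∧-conicalˡ; ∧-conicalʳ)
open import Data.Empty using (⊥; ⊥-elim)
open import Data.Fin using (Fin; toℕ; _≟_; _<?_) renaming (_<_ to _<ᶠ_)
open import Data.Fin.Permutation using (Permutation′; _⟨$⟩ʳ_; _⟨$⟩ˡ_; inverseˡ)
open import Data.Fin.Properties using (toℕ-injective)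
open import Data.List using (List; []; _∷_; _++_; [_]; length; take; drop; concat; replicate)
open import Data.List.Properties
  using (++-assoc; ++-identityʳ; ++-conicalˡ; ++-conicalʳ; concat-++; length-++; length-++-≤ˡ;
         take-all; length-take; length-drop; take++drop≡id; ∷-injective; ∷-injectiveˡ; ∷-injectiveʳ)
open import Data.List.Relation.Unary.All using (All; []; _∷_) renaming (map to mapAll)
import Data.List.Relation.Unary.All.Properties as All
import Data.List.Relation.Binary.Permutation.Propositional as Perm
open import Data.List.Relation.Binary.Permutation.Propositional
  using (_↭_; prep; swap; ↭-refl; ↭-trans; ↭-sym; ↭-reflexive)
open import Data.List.Relation.Binary.Permutation.Propositional.Properties
  using (All-resp-↭; ↭-length; ↭-empty-inv; ++⁺; ++⁺ˡ; ++⁺ʳ; ++-comm; shifts)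
open import Data.Maybe using (just; nothing)
open import Data.Maybe.Properties using (just-injective)
open import Data.Nat using (ℕ; zero; suc; _+_; _∸_; _≤_; _<_; z≤n; s≤s; ∣_-_∣)
open import Data.Nat.Tactic.RingSolver using (solve-∀)
import Data.Nat.Properties as ℕ
open import Data.Product using (_×_; _,_; proj₁; proj₂; ∃-syntax)
open import Data.Sum using (_⊎_; inj₁; inj₂) renaming (swap to ⊎-swap)
open import Data.Unit using (⊤; tt)
open import Function.Base using (_∘_)
open import Function.Bundles using (_⇔_; mk⇔)
open import Relation.Nullary using (Dec; yes; no; ¬_; contradiction)
open import Relation.Nullary.Decidable using (isYes; isYes≗does; dec-true; dec-false; does-⇔)
open import Relation.Binary.PropositionalEquality
  using (_≡_; _≢_; refl; sym; trans; cong; cong₂; subst; subst₂; ≢-sym; module ≡-Reasoning)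

isYes-true : {P : Set} (p? : Dec P) → P → isYes p? ≡ true
isYes-true p? p = trans (isYes≗does p?) (dec-true p? p)

isYes-false : {P : Set} (p? : Dec P) → ¬ P → isYes p? ≡ false
isYes-false p? ¬p = trans (isYes≗does p?) (dec-false p? ¬p)

isYes-⇔ : {P Q : Set} → P ⇔ Q → (p? : Dec P) (q? : Dec Q) → isYes p? ≡ isYes q?
isYes-⇔ P⇔Q p? q? = trans (isYes≗does p?) (trans (does-⇔ P⇔Q p? q?) (sym (isYes≗does q?)))

trues : List Bool → ℕ
trues []           = 0
trues (true ∷ bs)  = suc (trues bs)
trues (false ∷ bs) = trues bs

trues-++ : (bs cs : List Bool) → trues (bs ++ cs) ≡ trues bs + trues cs
trues-++ []           cs = refl
trues-++ (true ∷ bs)  cs = cong suc (trues-++ bs cs)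
trues-++ (false ∷ bs) cs = trues-++ bs cs

trues-++-∷-++ : (bs : List Bool) (z : Bool) (cs ds : List Bool) →
  trues (bs ++ z ∷ (cs ++ ds)) ≡ trues bs + (trues [ z ] + (trues cs + trues ds))
trues-++-∷-++ bs z cs ds =
  trans (trues-++ bs _) (cong (trues bs +_) (trans (trues-++ [ z ] _) (cong (trues [ z ] +_) (trues-++ cs ds))))

+-exchange : ∀ a z b t → a + (z + (b + t)) ≡ b + (z + (a + t))
+-exchange = solve-∀

trues-++-∷-comm : (z : Bool) (bs cs ds ds′ : List Bool) → trues ds ≡ trues ds′ →
  trues (bs ++ z ∷ (cs ++ ds)) ≡ trues (cs ++ z ∷ (bs ++ ds′))
trues-++-∷-comm z bs cs ds ds′ eq = begin
  trues (bs ++ z ∷ (cs ++ ds))                      ≡⟨ trues-++-∷-++ bs z cs ds ⟩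
  trues bs + (trues [ z ] + (trues cs + trues ds))  ≡⟨ cong (λ t → trues bs + (trues [ z ] + (trues cs + t))) eq ⟩
  trues bs + (trues [ z ] + (trues cs + trues ds′)) ≡⟨ +-exchange (trues bs) (trues [ z ]) (trues cs) (trues ds′) ⟩
  trues cs + (trues [ z ] + (trues bs + trues ds′)) ≡⟨ trues-++-∷-++ cs z bs ds′ ⟨
  trues (cs ++ z ∷ (bs ++ ds′))                     ∎
  where open ≡-Reasoning

trues-++-cong : {bs bs′ cs cs′ : List Bool} → trues bs ≡ trues bs′ → trues cs ≡ trues cs′ →
  trues (bs ++ cs) ≡ trues (bs′ ++ cs′)
trues-++-cong {bs} {bs′} {cs} {cs′} eq₁ eq₂ =
  trans (trues-++ bs cs) (trans (cong₂ _+_ eq₁ eq₂) (sym (trues-++ bs′ cs′)))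

truePositions : ℕ → List Bool → List ℕ
truePositions i []           = []
truePositions i (true ∷ bs)  = i ∷ truePositions (suc i) bs
truePositions i (false ∷ bs) = truePositions (suc i) bs

length-truePositions : (i : ℕ) (bs : List Bool) → length (truePositions i bs) ≡ trues bs
length-truePositions i []           = refl
length-truePositions i (true ∷ bs)  = cong suc (length-truePositions (suc i) bs)
length-truePositions i (false ∷ bs) = length-truePositions (suc i) bs

∣m-1+m∣≡1 : (m : ℕ) → ∣ m - suc m ∣ ≡ 1
∣m-1+m∣≡1 m = subst (λ k → ∣ m - k ∣ ≡ 1) (ℕ.+-comm m 1) (ℕ.∣m-m+n∣≡n m 1)

≤⊎≡+suc : (m k : ℕ) → m ≤ k ⊎ ∃[ m′ ] m ≡ k + suc m′
≤⊎≡+suc zero    k       = inj₁ z≤n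
≤⊎≡+suc (suc m) zero    = inj₂ (m , refl)
≤⊎≡+suc (suc m) (suc k) with ≤⊎≡+suc m k
... | inj₁ m≤k       = inj₁ (s≤s m≤k)
... | inj₂ (m′ , eq) = inj₂ (m′ , cong suc eq)

module _ {A : Set} where

  replicate-++-∷ : (c : A) (a b : ℕ) (xs : List A) →
    replicate a c ++ c ∷ (replicate b c ++ xs) ≡ replicate (suc (a + b)) c ++ xs
  replicate-++-∷ c zero    b xs = refl
  replicate-++-∷ c (suc a) b xs = cong (c ∷_) (replicate-++-∷ c a b xs)

  replicate-++-∷-comm : (c : A) (a b : ℕ) (xs : List A) →
    replicate a c ++ c ∷ (replicate b c ++ xs) ≡ replicate b c ++ c ∷ (replicate a c ++ xs)
  replicate-++-∷-comm c a b xs = begin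
    replicate a c ++ c ∷ (replicate b c ++ xs) ≡⟨ replicate-++-∷ c a b xs ⟩
    replicate (suc (a + b)) c ++ xs            ≡⟨ cong (λ k → replicate (suc k) c ++ xs) (ℕ.+-comm a b) ⟩
    replicate (suc (b + a)) c ++ xs            ≡⟨ sym (replicate-++-∷ c b a xs) ⟩
    replicate b c ++ c ∷ (replicate a c ++ xs) ∎
    where open ≡-Reasoning

  ++-∷-injective : (xs ys : List A) {x y : A} {us vs : List A} → length xs ≡ length ys →
    xs ++ x ∷ us ≡ ys ++ y ∷ vs → xs ≡ ys × x ≡ y × us ≡ vs
  ++-∷-injective []       []       _ eq with refl , refl ← ∷-injective eq = refl , refl , refl
  ++-∷-injective (x ∷ xs) (y ∷ ys) ∣xs∣≡∣ys∣ eq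
    with refl ← ∷-injectiveˡ eq
       | refl , refl , refl ← ++-∷-injective xs ys (ℕ.suc-injective ∣xs∣≡∣ys∣) (∷-injectiveʳ eq)
    = refl , refl , refl

  ++-overlap : (xs ys us vs : List A) → xs ++ ys ≡ us ++ vs →
    (∃[ m ] us ≡ xs ++ m × ys ≡ m ++ vs) ⊎ (∃[ m ] xs ≡ us ++ m × vs ≡ m ++ ys)
  ++-overlap []       ys us       vs eq = inj₁ (us , refl , eq)
  ++-overlap (x ∷ xs) ys []       vs eq = inj₂ (x ∷ xs , refl , sym eq)
  ++-overlap (x ∷ xs) ys (u ∷ us) vs eq with refl ← ∷-injectiveˡ eq | ++-overlap xs ys us vs (∷-injectiveʳ eq)
  ... | inj₁ (m , us≡ , ys≡) = inj₁ (m , cong (x ∷_) us≡ , ys≡)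
  ... | inj₂ (m , xs≡ , vs≡) = inj₂ (m , cong (x ∷_) xs≡ , vs≡)

  length-≡-≢[] : {xs ys : List A} → length xs ≡ length ys → ys ≢ [] → xs ≢ []
  length-≡-≢[] {ys = []}     _  ys≢[] = ⊥-elim (ys≢[] refl)
  length-≡-≢[] {ys = _ ∷ _} () _     refl

  take-length-++ : (xs ys : List A) → take (length xs) (xs ++ ys) ≡ xs
  take-length-++ []       ys = refl
  take-length-++ (x ∷ xs) ys = cong (x ∷_) (take-length-++ xs ys)

  drop-length-++ : (xs ys : List A) → drop (length xs) (xs ++ ys) ≡ ys
  drop-length-++ []       ys = refl
  drop-length-++ (x ∷ xs) ys = drop-length-++ xs ys

  take-length+-++ : (xs : List A) {ys : List A} (k : ℕ) → take (length xs + k) (xs ++ ys) ≡ xs ++ take k ys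
  take-length+-++ []       k = refl
  take-length+-++ (x ∷ xs) k = cong (x ∷_) (take-length+-++ xs k)

  drop-length+-++ : (xs : List A) {ys : List A} (k : ℕ) → drop (length xs + k) (xs ++ ys) ≡ drop k ys
  drop-length+-++ []       k = refl
  drop-length+-++ (x ∷ xs) k = drop-length+-++ xs k

  take-++-≤ : (k : ℕ) (xs : List A) {ys : List A} → k ≤ length xs → take k (xs ++ ys) ≡ take k xs
  take-++-≤ zero    xs       z≤n     = refl
  take-++-≤ (suc k) (x ∷ xs) (s≤s k≤) = cong (x ∷_) (take-++-≤ k xs k≤)

  drop-++-≤ : (k : ℕ) (xs : List A) {ys : List A} → k ≤ length xs → drop k (xs ++ ys) ≡ drop k xs ++ ys
  drop-++-≤ zero    xs       z≤n     = refl
  drop-++-≤ (suc k) (x ∷ xs) (s≤s k≤) = drop-++-≤ k xs k≤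

module _ {n : ℕ} where

  ==-refl : (x : Fin n) → (x == x) ≡ true
  ==-refl x = isYes-true (x ≟ x) refl

  ==-≢ : {x y : Fin n} → x ≢ y → (x == y) ≡ false
  ==-≢ {x} {y} = isYes-false (x ≟ y)

  ==⇒≡ : {x y : Fin n} → (x == y) ≡ true → x ≡ y
  ==⇒≡ {x} {y} eq with x ≟ y
  ... | yes x≡y = x≡y
  ==⇒≡ () | no _

  ==-false⇒≢ : {x y : Fin n} → (x == y) ≡ false → x ≢ y
  ==-false⇒≢ {x} eq refl = contradiction (trans (sym (==-refl x)) eq) λ ()

  OneOf : Fin n → Fin n → Fin n → Set
  OneOf x y z = z ≡ x ⊎ z ≡ y

  lastOf-++-∷ : (h : Fin n) (xs : List (Fin n)) (z : Fin n) (ys : List (Fin n)) →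
    lastOf h (xs ++ z ∷ ys) ≡ lastOf z ys
  lastOf-++-∷ h []       z ys = refl
  lastOf-++-∷ h (x ∷ xs) z ys = lastOf-++-∷ x xs z ys

  lastOf-All : {P : Fin n → Set} {h : Fin n} (w : List (Fin n)) → P h → All P w → P (lastOf h w)
  lastOf-All []      ph []         = ph
  lastOf-All (y ∷ w) ph (py ∷ pw) = lastOf-All w py pw

  lastOf-replicate : (x : Fin n) (m : ℕ) → lastOf x (replicate m x) ≡ x
  lastOf-replicate x m = lastOf-All {P = _≡ x} (replicate m x) refl (All.replicate⁺ m refl)

  ==-∧-true : {a b x y : Fin n} → (a == x) ∧ (b == y) ≡ true → a ≡ x × b ≡ y
  ==-∧-true {a} {b} {x} {y} eq =
    ==⇒≡ (∧-conicalˡ (a == x) (b == y) eq) , ==⇒≡ (∧-conicalʳ (a == x) (b == y) eq)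

  ==-∧-false : {a b x y : Fin n} → (a == x) ∧ (b == y) ≡ false → ¬ (a ≡ x × b ≡ y)
  ==-∧-false {a} {b} eq (refl , refl) = contradiction (trans (sym (cong₂ _∧_ (==-refl a) (==-refl b))) eq) λ ()

  ==-∧-≢ : {c x y : Fin n} → x ≢ y → (c == x) ∧ (c == y) ≡ false
  ==-∧-≢ {c} {x} {y} x≢y with c == x in c==x
  ... | false = refl
  ... | true  = ==-≢ (λ c≡y → x≢y (trans (sym (==⇒≡ c==x)) c≡y))

  rotate-++ : (xs ys : List (Fin n)) → rotate (length xs) (xs ++ ys) ≡ ys ++ xs
  rotate-++ xs ys = cong₂ _++_ (drop-length-++ xs ys) (take-length-++ xs ys)

  rotate-↭ : (k : ℕ) (w : List (Fin n)) → rotate k w ↭ w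
  rotate-↭ k w = ↭-trans (++-comm (drop k w) (take k w)) (↭-reflexive (take++drop≡id k w))

  OneOf⇒inRS : {r s x : Fin n} → OneOf r s x → inRS r s x ≡ true
  OneOf⇒inRS {r} (inj₁ refl) rewrite ==-refl r = refl
  OneOf⇒inRS {r} {s} (inj₂ refl) rewrite ==-refl s = ∨-zeroʳ (s == r)

  inRS⇒OneOf : {r s x : Fin n} → inRS r s x ≡ true → OneOf r s x
  inRS⇒OneOf {r} {s} {x} x∈ with x == r in x==r
  ... | true  = inj₁ (==⇒≡ x==r)
  ... | false = inj₂ (==⇒≡ x∈)

  inRS-false : {r s x : Fin n} → inRS r s x ≡ false → x ≢ r × x ≢ s
  inRS-false x∉ = (λ x≡r → contradiction (trans (sym x∉) (OneOf⇒inRS (inj₁ x≡r))) λ ()) ,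
                  (λ x≡s → contradiction (trans (sym x∉) (OneOf⇒inRS (inj₂ x≡s))) λ ())

  inRS-comm : (r s x : Fin n) → inRS s r x ≡ inRS r s x
  inRS-comm r s x = ∨-comm (x == s) (x == r)

  adjBitsFrom : (Fin n → Fin n → Bool) → Fin n → List (Fin n) → List Bool
  adjBitsFrom d x []      = []
  adjBitsFrom d x (y ∷ w) = d x y ∷ adjBitsFrom d y w

  adjBits : (Fin n → Fin n → Bool) → List (Fin n) → List Bool
  adjBits d []      = []
  adjBits d (x ∷ w) = adjBitsFrom d x w

  adjBitsFrom-++-∷ : (d : Fin n → Fin n → Bool) (x : Fin n) (xs : List (Fin n)) (z : Fin n) (ys : List (Fin n)) →
    adjBitsFrom d x (xs ++ z ∷ ys) ≡ adjBitsFrom d x xs ++ d (lastOf x xs) z ∷ adjBitsFrom d z ys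
  adjBitsFrom-++-∷ d x []       z ys = refl
  adjBitsFrom-++-∷ d x (y ∷ xs) z ys = cong (d x y ∷_) (adjBitsFrom-++-∷ d y xs z ys)

  adjBitsFrom-replicate : (d : Fin n → Fin n → Bool) (x : Fin n) (a : ℕ) (w : List (Fin n)) →
    adjBitsFrom d x (replicate a x ++ w) ≡ replicate a (d x x) ++ adjBitsFrom d x w
  adjBitsFrom-replicate d x zero    w = refl
  adjBitsFrom-replicate d x (suc a) w = cong (d x x ∷_) (adjBitsFrom-replicate d x a w)

  length-adjBitsFrom : (d : Fin n → Fin n → Bool) (x : Fin n) (w : List (Fin n)) →
    length (adjBitsFrom d x w) ≡ length w
  length-adjBitsFrom d x []      = refl
  length-adjBitsFrom d x (y ∷ w) = cong suc (length-adjBitsFrom d y w)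

  adjBitsFrom-constant : (d d′ : Fin n → Fin n → Bool) (c : Fin n) (w : List (Fin n)) → All (_≡ c) w →
    d c c ≡ d′ c c → adjBitsFrom d c w ≡ adjBitsFrom d′ c w
  adjBitsFrom-constant d d′ c []      []           eq = refl
  adjBitsFrom-constant d d′ c (y ∷ w) (refl ∷ pw) eq = cong₂ _∷_ eq (adjBitsFrom-constant d d′ y w pw eq)

  descent : (Fin n → Fin n) → Fin n → Fin n → Bool
  descent σ a b = isYes (σ b <? σ a)

  descent-irrefl : (σ : Fin n → Fin n) (x : Fin n) → descent σ x x ≡ false
  descent-irrefl σ x = isYes-false (σ x <? σ x) (ℕ.<-irrefl refl)

  desPos≡truePositions : (σ : Fin n → Fin n) (i : ℕ) (w : List (Fin n)) →
    desPos σ i w ≡ truePositions i (adjBits (descent σ) w)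
  desPos≡truePositions σ i []          = refl
  desPos≡truePositions σ i (a ∷ [])    = refl
  desPos≡truePositions σ i (a ∷ b ∷ w) with isYes (σ b <? σ a) | desPos≡truePositions σ (suc i) (b ∷ w)
  ... | true  | ih = cong (i ∷_) ih
  ... | false | ih = ih

  des≡trues : (σ : Fin n → Fin n) (w : List (Fin n)) → des σ w ≡ trues (adjBits (descent σ) w)
  des≡trues σ w =
    trans (cong length (desPos≡truePositions σ 1 w)) (length-truePositions 1 (adjBits (descent σ) w))

  plat≡trues : (w : List (Fin n)) → plat w ≡ trues (adjBits _==_ w)
  plat≡trues []          = refl
  plat≡trues (a ∷ [])    = refl
  plat≡trues (a ∷ b ∷ w) with a == b | plat≡trues (b ∷ w)
  ... | true  | ih = cong suc ih
  ... | false | ih = ih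

  -- Alternating words and the swapping of runs

  Run : Fin n → List (Fin n) → Set
  Run x R = ∃[ m ] R ≡ x ∷ replicate m x

  data RunPairs (x y : Fin n) : List (List (Fin n)) → Set where
    lastPair : ∀ {R₁ R₂}   → Run x R₁ → Run y R₂ → RunPairs x y (R₁ ∷ R₂ ∷ [])
    consPair : ∀ {R₁ R₂ L} → Run x R₁ → Run y R₂ → RunPairs x y L → RunPairs x y (R₁ ∷ R₂ ∷ L)

  -- the words x^a₁ y^b₁ ⋯ x^aⱼ y^bⱼ with j ≥ 1 and all aᵢ, bᵢ ≥ 1
  Alternating : Fin n → Fin n → List (Fin n) → Set
  Alternating x y V = ∃[ L ] RunPairs x y L × concat L ≡ V

  swapRunPairs : List (List (Fin n)) → List (List (Fin n))
  swapRunPairs = swapPairs {n}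

  swapRuns : List (Fin n) → List (Fin n)
  swapRuns V = concat (swapRunPairs (runs V))

  concat-consRun : (x : Fin n) (L : List (List (Fin n))) → concat (consRun x L) ≡ x ∷ concat L
  concat-consRun x []              = refl
  concat-consRun x ([] ∷ L)        = refl
  concat-consRun x ((y ∷ ys) ∷ L) with x == y
  ... | true  = refl
  ... | false = refl

  concat-runs : (w : List (Fin n)) → concat (runs w) ≡ w
  concat-runs []      = refl
  concat-runs (x ∷ w) = trans (concat-consRun x (runs w)) (cong (x ∷_) (concat-runs w))

  concat-swapRunPairs-↭ : (L : List (List (Fin n))) → concat (swapRunPairs L) ↭ concat L
  concat-swapRunPairs-↭ []          = ↭-refl
  concat-swapRunPairs-↭ (R ∷ [])    = ↭-refl
  concat-swapRunPairs-↭ (R ∷ S ∷ L) = ↭-trans (++⁺ˡ S (++⁺ˡ R (concat-swapRunPairs-↭ L))) (shifts S R)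

  swapRuns-↭ : (V : List (Fin n)) → swapRuns V ↭ V
  swapRuns-↭ V = ↭-trans (concat-swapRunPairs-↭ (runs V)) (↭-reflexive (concat-runs V))

  length-swapRuns : (V : List (Fin n)) → length (swapRuns V) ≡ length V
  length-swapRuns V = ↭-length (swapRuns-↭ V)

  FirstRunNot : Fin n → List (List (Fin n)) → Set
  FirstRunNot x []             = ⊤
  FirstRunNot x ([] ∷ _)       = ⊥
  FirstRunNot x ((z ∷ _) ∷ _) = z ≢ x

  runs-run : (x : Fin n) (m : ℕ) (v : List (Fin n)) → FirstRunNot x (runs v) →
    runs (x ∷ replicate m x ++ v) ≡ (x ∷ replicate m x) ∷ runs v
  runs-run x zero v fn with runs v
  ... | []              = refl
  ... | [] ∷ L          = ⊥-elim fn
  ... | (z ∷ zs) ∷ L rewrite ==-≢ {x} {z} (λ x≡z → fn (sym x≡z)) = refl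
  runs-run x (suc m) v fn rewrite runs-run x m v fn | ==-refl x = refl

  RunPairs-firstRunNot : {x y : Fin n} {L : List (List (Fin n))} → x ≢ y → RunPairs x y L → FirstRunNot y L
  RunPairs-firstRunNot x≢y (lastPair (_ , refl) _)   = x≢y
  RunPairs-firstRunNot x≢y (consPair (_ , refl) _ _) = x≢y

  runs-runPair : {x y : Fin n} → x ≢ y → (a b : ℕ) (v : List (Fin n)) → FirstRunNot y (runs v) →
    runs (x ∷ replicate a x ++ y ∷ replicate b y ++ v) ≡ (x ∷ replicate a x) ∷ (y ∷ replicate b y) ∷ runs v
  runs-runPair {x} {y} x≢y a b v fn =
    trans (runs-run x a _ (subst (FirstRunNot x) (sym runs-y) (≢-sym x≢y))) (cong (_ ∷_) runs-y)
    where
      runs-y : runs (y ∷ replicate b y ++ v) ≡ (y ∷ replicate b y) ∷ runs v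
      runs-y = runs-run y b v fn

  runs-concat : {x y : Fin n} {L : List (List (Fin n))} → x ≢ y → RunPairs x y L → runs (concat L) ≡ L
  runs-concat x≢y (lastPair (a , refl) (b , refl))   = runs-runPair x≢y a b [] tt
  runs-concat x≢y (consPair (a , refl) (b , refl) p) =
    trans (runs-runPair x≢y a b _ (subst (FirstRunNot _) (sym (runs-concat x≢y p)) (RunPairs-firstRunNot x≢y p)))
          (cong (λ L → _ ∷ _ ∷ L) (runs-concat x≢y p))

  RunPairs-swap : {x y : Fin n} {L : List (List (Fin n))} → RunPairs x y L → RunPairs y x (swapRunPairs L)
  RunPairs-swap (lastPair R₁ R₂)   = lastPair R₂ R₁
  RunPairs-swap (consPair R₁ R₂ p) = consPair R₂ R₁ (RunPairs-swap p)

  swapRunPairs-involutive : {x y : Fin n} {L : List (List (Fin n))} → RunPairs x y L →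
    swapRunPairs (swapRunPairs L) ≡ L
  swapRunPairs-involutive (lastPair _ _)   = refl
  swapRunPairs-involutive (consPair _ _ p) = cong (λ L → _ ∷ _ ∷ L) (swapRunPairs-involutive p)

  RunPairs-++ : {x y : Fin n} {L₁ L₂ : List (List (Fin n))} → RunPairs x y L₁ → RunPairs x y L₂ →
    RunPairs x y (L₁ ++ L₂)
  RunPairs-++ (lastPair R₁ R₂)   q = consPair R₁ R₂ q
  RunPairs-++ (consPair R₁ R₂ p) q = consPair R₁ R₂ (RunPairs-++ p q)

  swapRunPairs-++ : {x y : Fin n} {L₁ : List (List (Fin n))} (L₂ : List (List (Fin n))) → RunPairs x y L₁ →
    swapRunPairs (L₁ ++ L₂) ≡ swapRunPairs L₁ ++ swapRunPairs L₂
  swapRunPairs-++ L₂ (lastPair _ _)   = refl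
  swapRunPairs-++ L₂ (consPair _ _ p) = cong (λ L → _ ∷ _ ∷ L) (swapRunPairs-++ L₂ p)

  swapRuns-concat : {x y : Fin n} {L : List (List (Fin n))} → x ≢ y → RunPairs x y L →
    swapRuns (concat L) ≡ concat (swapRunPairs L)
  swapRuns-concat x≢y p = cong (concat ∘ swapRunPairs) (runs-concat x≢y p)

  swapRuns-alternating : {x y : Fin n} {V : List (Fin n)} → x ≢ y → Alternating x y V → Alternating y x (swapRuns V)
  swapRuns-alternating x≢y (L , p , refl) = swapRunPairs L , RunPairs-swap p , sym (swapRuns-concat x≢y p)

  swapRuns-involutive : {x y : Fin n} {V : List (Fin n)} → x ≢ y → Alternating x y V → swapRuns (swapRuns V) ≡ V
  swapRuns-involutive x≢y (L , p , refl) = begin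
    swapRuns (swapRuns (concat L))           ≡⟨ cong swapRuns (swapRuns-concat x≢y p) ⟩
    swapRuns (concat (swapRunPairs L))       ≡⟨ swapRuns-concat (≢-sym x≢y) (RunPairs-swap p) ⟩
    concat (swapRunPairs (swapRunPairs L))   ≡⟨ cong concat (swapRunPairs-involutive p) ⟩
    concat L                                 ∎
    where open ≡-Reasoning

  swapRuns-++ : {x y : Fin n} {V W : List (Fin n)} → x ≢ y → Alternating x y V → Alternating x y W →
    swapRuns (V ++ W) ≡ swapRuns V ++ swapRuns W
  swapRuns-++ x≢y (L₁ , p₁ , refl) (L₂ , p₂ , refl) = begin
    swapRuns (concat L₁ ++ concat L₂)
      ≡⟨ cong swapRuns (concat-++ L₁ L₂) ⟩
    swapRuns (concat (L₁ ++ L₂))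
      ≡⟨ swapRuns-concat x≢y (RunPairs-++ p₁ p₂) ⟩
    concat (swapRunPairs (L₁ ++ L₂))
      ≡⟨ cong concat (swapRunPairs-++ L₂ p₁) ⟩
    concat (swapRunPairs L₁ ++ swapRunPairs L₂)
      ≡⟨ concat-++ (swapRunPairs L₁) (swapRunPairs L₂) ⟨
    concat (swapRunPairs L₁) ++ concat (swapRunPairs L₂)
      ≡⟨ cong₂ _++_ (swapRuns-concat x≢y p₁) (swapRuns-concat x≢y p₂) ⟨
    swapRuns (concat L₁) ++ swapRuns (concat L₂) ∎
    where open ≡-Reasoning

  RunPairs-ends : {x y : Fin n} {L : List (List (Fin n))} → RunPairs x y L →
    ∃[ w ] concat L ≡ x ∷ w × lastOf x w ≡ y
  RunPairs-ends {x} {y} (lastPair (a , refl) (b , refl)) =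
    _ , refl , trans (lastOf-++-∷ x (replicate a x) y (replicate b y ++ []))
                     (trans (cong (lastOf y) (++-identityʳ (replicate b y))) (lastOf-replicate y b))
  RunPairs-ends {x} {y} (consPair {L = L} (a , refl) (b , refl) p) with RunPairs-ends p
  ... | w , concat≡ , last≡ = _ , refl ,
     trans (lastOf-++-∷ x (replicate a x) y (replicate b y ++ concat L))
      (trans (cong (λ t → lastOf y (replicate b y ++ t)) concat≡)
       (trans (lastOf-++-∷ y (replicate b y) x w) last≡))

  runPair-letters : {x y : Fin n} (a b : ℕ) {w : List (Fin n)} → All (OneOf x y) w →
    All (OneOf x y) (x ∷ replicate a x ++ y ∷ replicate b y ++ w)
  runPair-letters a b pw =
    inj₁ refl ∷ All.++⁺ (All.replicate⁺ a (inj₁ refl)) (inj₂ refl ∷ All.++⁺ (All.replicate⁺ b (inj₂ refl)) pw)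

  RunPairs-letters : {x y : Fin n} {L : List (List (Fin n))} → RunPairs x y L → All (OneOf x y) (concat L)
  RunPairs-letters (lastPair (a , refl) (b , refl))   = runPair-letters a b []
  RunPairs-letters (consPair (a , refl) (b , refl) p) = runPair-letters a b (RunPairs-letters p)

  alternating-ends : {x y : Fin n} {V : List (Fin n)} → Alternating x y V → ∃[ w ] V ≡ x ∷ w × lastOf x w ≡ y
  alternating-ends (L , p , refl) = RunPairs-ends p

  alternating-letters : {x y : Fin n} {V : List (Fin n)} → Alternating x y V → All (OneOf x y) V
  alternating-letters (L , p , refl) = RunPairs-letters p

  mutual
    alternating-intro : {x y : Fin n} → x ≢ y → (w : List (Fin n)) → All (OneOf x y) w → lastOf x w ≡ y →
      Alternating x y (x ∷ w)
    alternating-intro x≢y []      []                 last≡ = ⊥-elim (x≢y last≡)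
    alternating-intro {x} x≢y (z ∷ w) (inj₁ refl ∷ pw) last≡ with alternating-intro x≢y w pw last≡
    ... | _ , lastPair (m , refl) R₂ , eq   = _ , lastPair (suc m , refl) R₂ , cong (x ∷_) eq
    ... | _ , consPair (m , refl) R₂ p , eq = _ , consPair (suc m , refl) R₂ p , cong (x ∷_) eq
    alternating-intro {x} x≢y (z ∷ w) (inj₂ refl ∷ pw) last≡ with runThenAlternating x≢y w pw last≡
    ... | _ , _ , R₂ , inj₁ refl , eq = _ , lastPair (0 , refl) R₂ , cong (x ∷_) eq
    ... | _ , _ , R₂ , inj₂ p , eq    = _ , consPair (0 , refl) R₂ p , cong (x ∷_) eq

    runThenAlternating : {x y : Fin n} → x ≢ y → (w : List (Fin n)) → All (OneOf x y) w → lastOf y w ≡ y →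
      ∃[ R ] ∃[ L ] Run y R × (L ≡ [] ⊎ RunPairs x y L) × concat (R ∷ L) ≡ y ∷ w
    runThenAlternating x≢y []      []                 _     = _ , [] , (0 , refl) , inj₁ refl , refl
    runThenAlternating {y = y} x≢y (z ∷ w) (inj₁ refl ∷ pw) last≡ with alternating-intro x≢y w pw last≡
    ... | L , p , eq = _ , L , (0 , refl) , inj₂ p , cong (y ∷_) eq
    runThenAlternating {y = y} x≢y (z ∷ w) (inj₂ refl ∷ pw) last≡ with runThenAlternating x≢y w pw last≡
    ... | _ , L , (m , refl) , L≡ , eq = _ , L , (suc m , refl) , L≡ , cong (y ∷_) eq

  -- The block rules of f and F

  fBlock-↭ : (u : List (Fin n)) → fBlock u ↭ u
  fBlock-↭ []      = ↭-refl
  fBlock-↭ (h ∷ w) with h == lastOf h w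
  ... | true  = ↭-refl
  ... | false = swapRuns-↭ (h ∷ w)

  distinctEnds⇒alternating : {r s : Fin n} → r ≢ s → (h : Fin n) (w : List (Fin n)) → All (OneOf r s) (h ∷ w) →
    (h == lastOf h w) ≡ false → Alternating r s (h ∷ w) ⊎ Alternating s r (h ∷ w)
  distinctEnds⇒alternating r≢s h w (ph ∷ pw) ends with lastOf-All {P = OneOf _ _} w ph pw | ==-false⇒≢ ends
  distinctEnds⇒alternating r≢s h w (inj₁ refl ∷ pw) ends | inj₁ last≡ | h≢last = ⊥-elim (h≢last (sym last≡))
  distinctEnds⇒alternating r≢s h w (inj₁ refl ∷ pw) ends | inj₂ last≡ | _      = inj₁ (alternating-intro r≢s w pw last≡)
  distinctEnds⇒alternating r≢s h w (inj₂ refl ∷ pw) ends | inj₁ last≡ | _      =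
    inj₂ (alternating-intro (≢-sym r≢s) w (mapAll ⊎-swap pw) last≡)
  distinctEnds⇒alternating r≢s h w (inj₂ refl ∷ pw) ends | inj₂ last≡ | h≢last = ⊥-elim (h≢last (sym last≡))

  fBlock-alternating : {x y : Fin n} {V : List (Fin n)} → x ≢ y → Alternating x y V → fBlock V ≡ swapRuns V
  fBlock-alternating x≢y alt with alternating-ends alt
  ... | w , refl , last≡ rewrite last≡ | ==-≢ x≢y = refl

  fBlock-involutive : {r s : Fin n} → r ≢ s → (u : List (Fin n)) → All (OneOf r s) u → fBlock (fBlock u) ≡ u
  fBlock-involutive r≢s []      _  = refl
  fBlock-involutive r≢s (h ∷ w) pu with h == lastOf h w in ends
  ... | true rewrite ends = refl
  ... | false with distinctEnds⇒alternating r≢s h w pu ends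
  ...   | inj₁ alt = trans (fBlock-alternating (≢-sym r≢s) (swapRuns-alternating r≢s alt))
                           (swapRuns-involutive r≢s alt)
  ...   | inj₂ alt = trans (fBlock-alternating r≢s (swapRuns-alternating (≢-sym r≢s) alt))
                           (swapRuns-involutive (≢-sym r≢s) alt)

  Constant : List (Fin n) → Set
  Constant []      = ⊤
  Constant (h ∷ w) = All (_≡ h) w

  NoAdjacent : Fin n → Fin n → List (Fin n) → Set
  NoAdjacent y x (a ∷ b ∷ w) = ¬ (a ≡ y × b ≡ x) × NoAdjacent y x (b ∷ w)
  NoAdjacent y x _           = ⊤

  firstSR-nothing : (x y : Fin n) (j : ℕ) (u : List (Fin n)) → firstSR x y j u ≡ nothing → NoAdjacent y x u
  firstSR-nothing x y j []          _  = tt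
  firstSR-nothing x y j (a ∷ [])    _  = tt
  firstSR-nothing x y j (a ∷ b ∷ w) eq with (a == y) ∧ (b == x) in found | firstSR-nothing x y (suc j) (b ∷ w)
  ... | true  | _  = contradiction eq λ ()
  ... | false | ih = ==-∧-false found , ih eq

  firstSR-just : (x y : Fin n) (j : ℕ) (u : List (Fin n)) {i : ℕ} → firstSR x y j u ≡ just i →
    ∃[ p ] ∃[ q ] u ≡ p ++ y ∷ x ∷ q × i ≡ suc (length p + j)
  firstSR-just x y j (a ∷ b ∷ w) eq with (a == y) ∧ (b == x) in found | firstSR-just x y (suc j) (b ∷ w)
  ... | true | _ with refl , refl ← ==-∧-true {a} {b} {y} {x} found = [] , w , refl , sym (just-injective eq)
  ... | false | ih with p , q , u≡ , i≡ ← ih eq =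
    a ∷ p , q , cong (a ∷_) u≡ , trans i≡ (cong suc (ℕ.+-suc (length p) j))

  constant-from-y : {x y : Fin n} (w : List (Fin n)) → NoAdjacent y x (y ∷ w) → All (OneOf x y) w → All (_≡ y) w
  constant-from-y []      _             []                = []
  constant-from-y (b ∷ w) (no-yx , _)    (inj₁ refl ∷ pw) = ⊥-elim (no-yx (refl , refl))
  constant-from-y (b ∷ w) (_ , no-yx′)   (inj₂ refl ∷ pw) = refl ∷ constant-from-y w no-yx′ pw

  constant-from-x : {x y : Fin n} (w : List (Fin n)) → NoAdjacent y x (x ∷ w) → All (OneOf x y) w → lastOf x w ≢ y →
    All (_≡ x) w
  constant-from-x []      _           []                _      = []
  constant-from-x (b ∷ w) (_ , no-yx) (inj₁ refl ∷ pw) last≢ = refl ∷ constant-from-x w no-yx pw last≢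
  constant-from-x {y = y} (b ∷ w) (_ , no-yx) (inj₂ refl ∷ pw) last≢ =
    ⊥-elim (last≢ (lastOf-All {P = _≡ y} w refl (constant-from-y w no-yx pw)))

  cutPoint-nothing⇒constant : {x y : Fin n} (u : List (Fin n)) → All (OneOf x y) u → cutPoint x y u ≡ nothing →
    Constant u
  cutPoint-nothing⇒constant []      _  _  = tt
  cutPoint-nothing⇒constant {x} {y} (h ∷ w) (ph ∷ pw) eq with (h == x) ∧ (lastOf h w == y) in cut₀
  ... | true  = contradiction eq λ ()
  ... | false with ph
  ...   | inj₁ refl =
    constant-from-x w (firstSR-nothing x y 0 (h ∷ w) eq) pw (λ last≡ → ==-∧-false cut₀ (refl , last≡))
  ...   | inj₂ refl = constant-from-y w (firstSR-nothing x y 0 (h ∷ w) eq) pw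

  firstSR-constant : {x y : Fin n} → x ≢ y → (j : ℕ) (c : Fin n) (w : List (Fin n)) → All (_≡ c) w →
    firstSR x y j (c ∷ w) ≡ nothing
  firstSR-constant x≢y j c []       []          = refl
  firstSR-constant x≢y j c (c′ ∷ w) (refl ∷ pw) rewrite ==-∧-≢ {c′} (≢-sym x≢y) =
    firstSR-constant x≢y (suc j) c′ w pw

  constant⇒cutPoint-nothing : {x y : Fin n} → x ≢ y → (u : List (Fin n)) → Constant u → cutPoint x y u ≡ nothing
  constant⇒cutPoint-nothing x≢y []      _  = refl
  constant⇒cutPoint-nothing x≢y (c ∷ w) pw rewrite lastOf-All {P = _≡ c} w refl pw | ==-∧-≢ {c} x≢y =
    firstSR-constant x≢y 0 c w pw

  FBlock-nothing : {x y : Fin n} (u : List (Fin n)) → cutPoint x y u ≡ nothing → FBlock x y u ≡ u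
  FBlock-nothing u eq rewrite eq = refl

  FBlock-constant : {x y : Fin n} → x ≢ y → (u : List (Fin n)) → Constant u → FBlock x y u ≡ u
  FBlock-constant x≢y u c = FBlock-nothing u (constant⇒cutPoint-nothing x≢y u c)

  -- u = p ++ q is split at one of the paper's splitting points (an s followed by an r, read cyclically)
  CyclicCut : Fin n → Fin n → List (Fin n) → List (Fin n) → List (Fin n) → Set
  CyclicCut x y u p q = u ≡ p ++ q × q ≢ [] × Alternating x y (q ++ p)

  cyclicSwap : List (Fin n) → List (Fin n) → List (Fin n)
  cyclicSwap p q = rotate (length q) (swapRuns (q ++ p))

  adjacent-yx⇒cut : {x y : Fin n} → x ≢ y → (u p q : List (Fin n)) → u ≡ p ++ y ∷ x ∷ q → All (OneOf x y) u →
    CyclicCut x y u (p ++ [ y ]) (x ∷ q)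
  adjacent-yx⇒cut {x} {y} x≢y u p q refl pu =
    sym (++-assoc p [ y ] (x ∷ q)) , (λ ()) , alternating-intro x≢y (q ++ p ++ [ y ]) letters last≡y
    where
      letters : All (OneOf x y) (q ++ p ++ [ y ])
      letters with _ ∷ _ ∷ pq ← All.++⁻ʳ p pu = All.++⁺ pq (All.++⁺ (All.++⁻ˡ p pu) (inj₂ refl ∷ []))
      last≡y : lastOf x (q ++ p ++ [ y ]) ≡ y
      last≡y = trans (cong (lastOf x) (sym (++-assoc q p [ y ]))) (lastOf-++-∷ x (q ++ p) y [])

  cutPoint-just⇒cut : {x y : Fin n} → x ≢ y → (u : List (Fin n)) → All (OneOf x y) u → {i : ℕ} →
    cutPoint x y u ≡ just i → ∃[ p ] ∃[ q ] CyclicCut x y u p q × length p ≡ i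
  cutPoint-just⇒cut {x} {y} x≢y (h ∷ w) (ph ∷ pw) eq with (h == x) ∧ (lastOf h w == y) in cut₀
  ... | true with refl , last≡ ← ==-∧-true {h} {lastOf h w} {x} {y} cut₀ =
    [] , h ∷ w ,
    (refl , (λ ()) , subst (Alternating x y) (sym (++-identityʳ (h ∷ w))) (alternating-intro x≢y w pw last≡)) ,
    just-injective eq
  ... | false with firstSR-just x y 0 (h ∷ w) eq
  ...   | p , q , u≡ , refl =
    p ++ [ y ] , x ∷ q , adjacent-yx⇒cut x≢y (h ∷ w) p q u≡ (ph ∷ pw) ,
    trans (length-++ p) (trans (ℕ.+-comm (length p) 1) (cong suc (sym (ℕ.+-identityʳ (length p)))))

  cyclicSwap-rotate : (p q : List (Fin n)) →
    rotate (length (p ++ q) ∸ length p) (swapRuns (rotate (length p) (p ++ q))) ≡ cyclicSwap p q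
  cyclicSwap-rotate p q =
    cong₂ rotate (trans (cong (_∸ length p) (length-++ p)) (ℕ.m+n∸m≡n (length p) (length q)))
                 (cong swapRuns (rotate-++ p q))

  cut-letters : {x y : Fin n} {u p q : List (Fin n)} → CyclicCut x y u p q → All (OneOf x y) u
  cut-letters {q = q} (refl , _ , alt) =
    All.++⁺ (All.++⁻ʳ q (alternating-letters alt)) (All.++⁻ˡ q (alternating-letters alt))

  alternating-split : {x y : Fin n} → x ≢ y → (V W : List (Fin n)) → V ≢ [] → W ≢ [] →
    Alternating x y (V ++ W) → Alternating x y (W ++ V) → Alternating x y V × Alternating x y W
  alternating-split x≢y []      _       V≢[] _    _    _ = ⊥-elim (V≢[] refl)
  alternating-split x≢y (_ ∷ _) []      _    W≢[] _    _ = ⊥-elim (W≢[] refl)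
  alternating-split {x} x≢y (_ ∷ V) (_ ∷ W) _ _ alt₁ alt₂
    with alternating-ends alt₁ | alternating-ends alt₂ | alternating-letters alt₁
  ... | _ , refl , last₁ | _ , refl , last₂ | _ ∷ letters =
    alternating-intro x≢y V (All.++⁻ˡ V letters) (trans (sym (lastOf-++-∷ x W x V)) last₂) ,
    alternating-intro x≢y W tail-letters (trans (sym (lastOf-++-∷ x V x W)) last₁)
    where tail-letters : All (OneOf _ _) W
          tail-letters with _ ∷ pw ← All.++⁻ʳ V letters = pw

  rotate-swapRuns-++ : {x y : Fin n} → x ≢ y → {V W : List (Fin n)} → Alternating x y V → Alternating x y W →
    (k : ℕ) → k ≤ length W → rotate (length V + k) (swapRuns (V ++ W)) ≡ rotate k (swapRuns (W ++ V))
  rotate-swapRuns-++ x≢y {V} {W} altV altW k k≤ = begin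
    rotate (length V + k) (swapRuns (V ++ W))
      ≡⟨ cong₂ (λ m z → rotate (m + k) z) (sym (length-swapRuns V)) (swapRuns-++ x≢y altV altW) ⟩
    drop (length V′ + k) (V′ ++ W′) ++ take (length V′ + k) (V′ ++ W′)
      ≡⟨ cong₂ _++_ (drop-length+-++ V′ k) (take-length+-++ V′ k) ⟩
    drop k W′ ++ (V′ ++ take k W′)
      ≡⟨ ++-assoc (drop k W′) V′ (take k W′) ⟨
    (drop k W′ ++ V′) ++ take k W′
      ≡⟨ cong₂ _++_ (drop-++-≤ k W′ k≤′) (take-++-≤ k W′ k≤′) ⟨
    rotate k (W′ ++ V′)
      ≡⟨ cong (rotate k) (swapRuns-++ x≢y altW altV) ⟨
    rotate k (swapRuns (W ++ V)) ∎
    where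
      open ≡-Reasoning
      V′ W′ : List (Fin n)
      V′ = swapRuns V
      W′ = swapRuns W
      k≤′ : k ≤ length W′
      k≤′ = subst (k ≤_) (sym (length-swapRuns W)) k≤

  -- moving a prefix M of the cut piece q to the end of p shifts the cut by whole run pairs
  cyclicSwap-shift : {x y : Fin n} → x ≢ y → (p q M : List (Fin n)) → q ≢ [] →
    Alternating x y ((M ++ q) ++ p) → Alternating x y (q ++ p ++ M) → cyclicSwap p (M ++ q) ≡ cyclicSwap (p ++ M) q
  cyclicSwap-shift x≢y p q []      _    _   _    = cong (λ p → cyclicSwap p q) (sym (++-identityʳ p))
  cyclicSwap-shift x≢y p q M@(_ ∷ _) q≢[] alt alt′
    with altM , altQP ← alternating-split x≢y M (q ++ p) (λ ()) (q≢[] ∘ ++-conicalˡ q p)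
                          (subst (Alternating _ _) (++-assoc M q p) alt)
                          (subst (Alternating _ _) (sym (++-assoc q p M)) alt′)
    = begin
    rotate (length (M ++ q)) (swapRuns ((M ++ q) ++ p))
      ≡⟨ cong₂ (λ k z → rotate k (swapRuns z)) (length-++ M) (++-assoc M q p) ⟩
    rotate (length M + length q) (swapRuns (M ++ q ++ p))
      ≡⟨ rotate-swapRuns-++ x≢y altM altQP (length q) (length-++-≤ˡ q) ⟩
    rotate (length q) (swapRuns ((q ++ p) ++ M))
      ≡⟨ cong (λ z → rotate (length q) (swapRuns z)) (++-assoc q p M) ⟩
    rotate (length q) (swapRuns (q ++ p ++ M)) ∎
    where open ≡-Reasoning

  cyclicSwap-unique : {x y : Fin n} {u p q p′ q′ : List (Fin n)} → x ≢ y →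
    CyclicCut x y u p q → CyclicCut x y u p′ q′ → cyclicSwap p q ≡ cyclicSwap p′ q′
  cyclicSwap-unique {p = p} {q} {p′} {q′} x≢y (u≡ , q≢[] , alt) (u≡′ , q′≢[] , alt′)
    with ++-overlap p q p′ q′ (trans (sym u≡) u≡′)
  ... | inj₁ (M , refl , refl) = cyclicSwap-shift x≢y p q′ M q′≢[] alt alt′
  ... | inj₂ (M , refl , refl) = sym (cyclicSwap-shift x≢y p′ q M q≢[] alt′ alt)

  cut⇒nonconstant : {x y : Fin n} {u p q : List (Fin n)} → x ≢ y → CyclicCut x y u p q → ¬ Constant u
  cut⇒nonconstant {u = []}    {p} {q} _ (u≡ , q≢[] , _) _ = q≢[] (++-conicalʳ p q (sym u≡))
  cut⇒nonconstant {x} {u = h ∷ w} {p} {q} x≢y (u≡ , _ , alt) const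
    with alternating-ends alt | subst (All (_≡ h)) u≡ (refl ∷ const)
  ... | w′ , qp≡ , last≡ | pu
    with refl ∷ pw′ ← subst (All (_≡ h)) qp≡ (All.++⁺ (All.++⁻ʳ p pu) (All.++⁻ˡ p pu)) =
    x≢y (trans (sym (lastOf-All {P = _≡ x} w′ refl pw′)) last≡)

  FBlock-cases : {x y : Fin n} → x ≢ y → (u : List (Fin n)) → All (OneOf x y) u →
    Constant u × FBlock x y u ≡ u ⊎ ∃[ p ] ∃[ q ] CyclicCut x y u p q × FBlock x y u ≡ cyclicSwap p q
  FBlock-cases {x} {y} x≢y u pu with cutPoint x y u in eq
  ... | nothing = inj₁ (cutPoint-nothing⇒constant u pu eq , refl)
  ... | just i with cutPoint-just⇒cut x≢y u pu eq
  ...   | p , q , cut@(refl , _) , refl = inj₂ (p , q , cut , cyclicSwap-rotate p q)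

  FBlock-cut : {x y : Fin n} {u p q : List (Fin n)} → x ≢ y → CyclicCut x y u p q → FBlock x y u ≡ cyclicSwap p q
  FBlock-cut {u = u} x≢y cut with FBlock-cases x≢y u (cut-letters cut)
  ... | inj₁ (const , _)          = ⊥-elim (cut⇒nonconstant x≢y cut const)
  ... | inj₂ (p′ , q′ , cut′ , eq) = trans eq (cyclicSwap-unique x≢y cut′ cut)

  cyclicSwap-cut : {x y : Fin n} {p q : List (Fin n)} → x ≢ y → q ≢ [] → Alternating x y (q ++ p) →
    ∃[ p′ ] ∃[ q′ ] CyclicCut y x (cyclicSwap p q) p′ q′ ×
      length p′ ≡ length p × length q′ ≡ length q × q′ ++ p′ ≡ swapRuns (q ++ p)
  cyclicSwap-cut {p = p} {q} x≢y q≢[] alt =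
    drop (length q) W , take (length q) W ,
    (refl , length-≡-≢[] |q′| q≢[] ,
     subst (Alternating _ _) (sym (take++drop≡id (length q) W)) (swapRuns-alternating x≢y alt)) ,
    |p′| , |q′| , take++drop≡id (length q) W
    where
      W : List (Fin n)
      W = swapRuns (q ++ p)
      |W| : length W ≡ length q + length p
      |W| = trans (length-swapRuns (q ++ p)) (length-++ q)
      |q′| : length (take (length q) W) ≡ length q
      |q′| = trans (length-take (length q) W)
                   (ℕ.m≤n⇒m⊓n≡m (subst (length q ≤_) (sym |W|) (ℕ.m≤m+n (length q) (length p))))
      |p′| : length (drop (length q) W) ≡ length p
      |p′| = trans (length-drop (length q) W) (trans (cong (_∸ length q) |W|) (ℕ.m+n∸m≡n (length q) (length p)))

  FBlock-involutive : {r s : Fin n} → r ≢ s → (u : List (Fin n)) → All (OneOf r s) u →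
    FBlock s r (FBlock r s u) ≡ u
  FBlock-involutive r≢s u pu with FBlock-cases r≢s u pu
  ... | inj₁ (const , eq) rewrite eq = FBlock-constant (≢-sym r≢s) u const
  ... | inj₂ (p , q , (u≡ , q≢[] , alt) , eq) rewrite eq with cyclicSwap-cut r≢s q≢[] alt
  ...   | p′ , q′ , cut′ , _ , |q′| , q′p′≡ = begin
    FBlock _ _ (cyclicSwap p q)                      ≡⟨ FBlock-cut (≢-sym r≢s) cut′ ⟩
    rotate (length q′) (swapRuns (q′ ++ p′))         ≡⟨ cong₂ rotate |q′| (cong swapRuns q′p′≡) ⟩
    rotate (length q) (swapRuns (swapRuns (q ++ p))) ≡⟨ cong (rotate (length q)) (swapRuns-involutive r≢s alt) ⟩
    rotate (length q) (q ++ p)                       ≡⟨ rotate-++ q p ⟩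
    p ++ q                                           ≡⟨ u≡ ⟨
    u                                                ∎
    where open ≡-Reasoning

  FBlock-↭ : (x y : Fin n) (u : List (Fin n)) → FBlock x y u ↭ u
  FBlock-↭ x y u with cutPoint x y u
  ... | nothing = ↭-refl
  ... | just i  = ↭-trans (rotate-↭ (length u ∸ i) _) (↭-trans (swapRuns-↭ _) (rotate-↭ i u))

  adjBits-runPair : (d : Fin n → Fin n → Bool) (x y : Fin n) (a b : ℕ) (L : List (List (Fin n))) →
    adjBits d (concat ((x ∷ replicate a x) ∷ (y ∷ replicate b y) ∷ L)) ≡
    replicate a (d x x) ++ d x y ∷ (replicate b (d y y) ++ adjBitsFrom d y (concat L))
  adjBits-runPair d x y a b L =
    trans (adjBitsFrom-replicate d x a _)
          (cong (λ t → replicate a (d x x) ++ d x y ∷ t) (adjBitsFrom-replicate d y b (concat L)))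

  adjBitsFrom-RunPairs : (d : Fin n → Fin n → Bool) {x y : Fin n} (z : Fin n) {L : List (List (Fin n))} →
    RunPairs x y L → adjBitsFrom d z (concat L) ≡ d z x ∷ adjBits d (concat L)
  adjBitsFrom-RunPairs d z (lastPair (_ , refl) (_ , refl))   = refl
  adjBitsFrom-RunPairs d z (consPair (_ , refl) (_ , refl) _) = refl

  -- The bits of x^a y^b are (d x x)^a (d x y) (d y y)^b, followed by the bit d y x towards the next pair;
  -- those of the swapped y^b x^a are (d′ y y)^b (d′ y x) (d′ x x)^a, followed by d′ x y.
  module SwapRunsBits (d d′ : Fin n → Fin n → Bool) {x y : Fin n} (x≢y : x ≢ y) where

    module Positions (dxx : d x x ≡ false) (dxy : d x y ≡ false) (dyy : d y y ≡ false)
                     (d′yy : d′ y y ≡ false) (d′yx : d′ y x ≡ false) (d′xx : d′ x x ≡ false)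
                     (boundary : d y x ≡ d′ x y) where

      runPair : (a b : ℕ) (bs : List Bool) →
        replicate a (d x x) ++ d x y ∷ (replicate b (d y y) ++ bs) ≡
        replicate b (d′ y y) ++ d′ y x ∷ (replicate a (d′ x x) ++ bs)
      runPair a b bs rewrite dxx | dxy | dyy | d′yy | d′yx | d′xx = replicate-++-∷-comm false a b bs

      adjBits-swapRunPairs : {L : List (List (Fin n))} → RunPairs x y L →
        adjBits d (concat L) ≡ adjBits d′ (concat (swapRunPairs L))
      adjBits-swapRunPairs (lastPair (a , refl) (b , refl)) =
        trans (adjBits-runPair d x y a b []) (trans (runPair a b []) (sym (adjBits-runPair d′ y x b a [])))
      adjBits-swapRunPairs (consPair {L = L} (a , refl) (b , refl) p) = begin
        adjBits d (concat ((x ∷ replicate a x) ∷ (y ∷ replicate b y) ∷ L))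
          ≡⟨ adjBits-runPair d x y a b L ⟩
        replicate a (d x x) ++ d x y ∷ (replicate b (d y y) ++ adjBitsFrom d y (concat L))
          ≡⟨ cong (λ t → replicate a (d x x) ++ d x y ∷ (replicate b (d y y) ++ t)) rest ⟩
        replicate a (d x x) ++ d x y ∷ (replicate b (d y y) ++ adjBitsFrom d′ x (concat (swapRunPairs L)))
          ≡⟨ runPair a b _ ⟩
        replicate b (d′ y y) ++ d′ y x ∷ (replicate a (d′ x x) ++ adjBitsFrom d′ x (concat (swapRunPairs L)))
          ≡⟨ adjBits-runPair d′ y x b a (swapRunPairs L) ⟨
        adjBits d′ (concat ((y ∷ replicate b y) ∷ (x ∷ replicate a x) ∷ swapRunPairs L)) ∎
        where
          open ≡-Reasoning
          rest : adjBitsFrom d y (concat L) ≡ adjBitsFrom d′ x (concat (swapRunPairs L))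
          rest = trans (adjBitsFrom-RunPairs d y p)
                  (trans (cong₂ _∷_ boundary (adjBits-swapRunPairs p))
                         (sym (adjBitsFrom-RunPairs d′ x (RunPairs-swap p))))

      adjBits-swapRuns : {V : List (Fin n)} → Alternating x y V → adjBits d V ≡ adjBits d′ (swapRuns V)
      adjBits-swapRuns (L , p , refl) =
        trans (adjBits-swapRunPairs p) (cong (adjBits d′) (sym (swapRuns-concat x≢y p)))

    module Count (e : Bool) (dxx : d x x ≡ e) (dyy : d y y ≡ e) (d′xx : d′ x x ≡ e) (d′yy : d′ y y ≡ e)
                 (inner : d x y ≡ d′ y x) (boundary : d y x ≡ d′ x y) where

      runPair : (a b : ℕ) (bs bs′ : List Bool) → trues bs ≡ trues bs′ →
        trues (replicate a (d x x) ++ d x y ∷ (replicate b (d y y) ++ bs)) ≡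
        trues (replicate b (d′ y y) ++ d′ y x ∷ (replicate a (d′ x x) ++ bs′))
      runPair a b bs bs′ eq rewrite dxx | dyy | d′xx | d′yy | inner =
        trues-++-∷-comm (d′ y x) (replicate a e) (replicate b e) bs bs′ eq

      trues-adjBits-swapRunPairs : {L : List (List (Fin n))} → RunPairs x y L →
        trues (adjBits d (concat L)) ≡ trues (adjBits d′ (concat (swapRunPairs L)))
      trues-adjBits-swapRunPairs (lastPair (a , refl) (b , refl)) =
        trans (cong trues (adjBits-runPair d x y a b []))
         (trans (runPair a b [] [] refl) (sym (cong trues (adjBits-runPair d′ y x b a []))))
      trues-adjBits-swapRunPairs (consPair {L = L} (a , refl) (b , refl) p) =
        trans (cong trues (adjBits-runPair d x y a b L))
         (trans (runPair a b _ _ rest) (sym (cong trues (adjBits-runPair d′ y x b a (swapRunPairs L)))))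
        where
          rest : trues (adjBitsFrom d y (concat L)) ≡ trues (adjBitsFrom d′ x (concat (swapRunPairs L)))
          rest rewrite adjBitsFrom-RunPairs d y p | adjBitsFrom-RunPairs d′ x (RunPairs-swap p) | boundary =
            trues-++-cong {[ d′ x y ]} {[ d′ x y ]} refl (trues-adjBits-swapRunPairs p)

      trues-adjBits-swapRuns : {V : List (Fin n)} → Alternating x y V →
        trues (adjBits d V) ≡ trues (adjBits d′ (swapRuns V))
      trues-adjBits-swapRuns (L , p , refl) =
        trans (trues-adjBits-swapRunPairs p) (cong (trues ∘ adjBits d′) (sym (swapRuns-concat x≢y p)))

  adjBits-swapHalves : (d d′ : Fin n → Fin n → Bool) (a : Fin n) (p : List (Fin n)) (b : Fin n) (q : List (Fin n))
    (a′ : Fin n) (p′ : List (Fin n)) (b′ : Fin n) (q′ : List (Fin n)) → length q ≡ length q′ →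
    d (lastOf a p) b ≡ d′ (lastOf a′ p′) b′ →
    adjBits d (b ∷ q ++ a ∷ p) ≡ adjBits d′ (b′ ∷ q′ ++ a′ ∷ p′) →
    adjBits d (a ∷ p ++ b ∷ q) ≡ adjBits d′ (a′ ∷ p′ ++ b′ ∷ q′)
  adjBits-swapHalves d d′ a p b q a′ p′ b′ q′ |q|≡ junction eq
    with Q≡Q′ , _ , P≡P′ ← ++-∷-injective (adjBitsFrom d b q) (adjBitsFrom d′ b′ q′)
                             (trans (length-adjBitsFrom d b q) (trans |q|≡ (sym (length-adjBitsFrom d′ b′ q′))))
                             (trans (sym (adjBitsFrom-++-∷ d b q a p)) (trans eq (adjBitsFrom-++-∷ d′ b′ q′ a′ p′))) =
    trans (adjBitsFrom-++-∷ d a p b q)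
     (trans (cong₂ _++_ P≡P′ (cong₂ _∷_ junction Q≡Q′)) (sym (adjBitsFrom-++-∷ d′ a′ p′ b′ q′)))

  -- Letter counts and the ballot condition

  count-++ : (j : Fin n) (xs ys : List (Fin n)) → count j (xs ++ ys) ≡ count j xs + count j ys
  count-++ j []       ys = refl
  count-++ j (x ∷ xs) ys with j == x
  ... | true  = cong suc (count-++ j xs ys)
  ... | false = count-++ j xs ys

  count-++-∷ : (j : Fin n) (xs : List (Fin n)) (x : Fin n) (ys : List (Fin n)) →
    count j (xs ++ x ∷ ys) ≡ count j (xs ++ [ x ]) + count j ys
  count-++-∷ j xs x ys = trans (cong (count j) (sym (++-assoc xs [ x ] ys))) (count-++ j (xs ++ [ x ]) ys)

  count-↭ : (j : Fin n) {xs ys : List (Fin n)} → xs ↭ ys → count j xs ≡ count j ys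
  count-↭ j Perm.refl = refl
  count-↭ j (prep x p) with j == x
  ... | true  = cong suc (count-↭ j p)
  ... | false = count-↭ j p
  count-↭ j (swap x y p) with j == x | j == y
  ... | true  | true  = cong (suc ∘ suc) (count-↭ j p)
  ... | true  | false = cong suc (count-↭ j p)
  ... | false | true  = cong suc (count-↭ j p)
  ... | false | false = count-↭ j p
  count-↭ j (Perm.trans p q) = trans (count-↭ j p) (count-↭ j q)

  count-take-≤ : (j : Fin n) (m : ℕ) (xs : List (Fin n)) → count j (take m xs) ≤ count j xs
  count-take-≤ j zero    xs       = z≤n
  count-take-≤ j (suc m) []       = z≤n
  count-take-≤ j (suc m) (x ∷ xs) with j == x
  ... | true  = s≤s (count-take-≤ j m xs)
  ... | false = count-take-≤ j m xs

  count-take-length-++-∷ : (j : Fin n) (xs : List (Fin n)) (x : Fin n) (ys : List (Fin n)) (m : ℕ) →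
    count j (take (length xs + suc m) (xs ++ x ∷ ys)) ≡ count j (xs ++ [ x ]) + count j (take m ys)
  count-take-length-++-∷ j xs x ys m =
    trans (cong (count j) (take-length+-++ xs (suc m))) (count-++-∷ j xs x (take m ys))

  Ballot : (Fin n → ℕ) → Set
  Ballot c = (j j′ : Fin n) → toℕ j′ ≡ suc (toℕ j) → c j′ ≤ c j

  Ballot-resp : {c c′ : Fin n → ℕ} → ((j : Fin n) → c j ≡ c′ j) → Ballot c → Ballot c′
  Ballot-resp c≗c′ ballot j j′ j′≡ = subst₂ _≤_ (c≗c′ j′) (c≗c′ j) (ballot j j′ j′≡)

  nonAdjacent : (r s : Fin n) → 1 < ∣ toℕ r - toℕ s ∣ →
    (j j′ : Fin n) → toℕ j′ ≡ suc (toℕ j) → inRS r s j ≡ true → inRS r s j′ ≡ true → ⊥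
  nonAdjacent r s r≁s j j′ j′≡ j∈ j′∈ with inRS⇒OneOf {r} {s} {j} j∈ | inRS⇒OneOf {r} {s} {j′} j′∈
  ... | inj₁ refl | inj₁ refl = ℕ.1+n≢n (sym j′≡)
  ... | inj₂ refl | inj₂ refl = ℕ.1+n≢n (sym j′≡)
  ... | inj₁ refl | inj₂ refl =
    ℕ.<-irrefl (sym (trans (cong (λ t → ∣ toℕ r - t ∣) j′≡) (∣m-1+m∣≡1 (toℕ r)))) r≁s
  ... | inj₂ refl | inj₁ refl =
    ℕ.<-irrefl (sym (trans (cong (λ t → ∣ t - toℕ s ∣) j′≡)
                           (trans (ℕ.∣-∣-comm (suc (toℕ s)) (toℕ s)) (∣m-1+m∣≡1 (toℕ s))))) r≁s

  blockMap-comm : (r s : Fin n) (g : List (Fin n) → List (Fin n)) (acc w : List (Fin n)) →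
    blockMap s r g acc w ≡ blockMap r s g acc w
  blockMap-comm r s g acc []      = refl
  blockMap-comm r s g acc (x ∷ w) rewrite inRS-comm r s x with inRS r s x
  ... | true  = blockMap-comm r s g (acc ++ [ x ]) w
  ... | false = cong (λ t → g acc ++ x ∷ t) (blockMap-comm r s g [] w)

  consecutive-< : {a b c : Fin n} → toℕ b ≡ suc (toℕ a) → toℕ c ≢ toℕ a → toℕ c ≢ toℕ b →
    (a <ᶠ c ⇔ b <ᶠ c) × (c <ᶠ a ⇔ c <ᶠ b)
  consecutive-< {a} {b} {c} b≡ c≢a c≢b =
    mk⇔ (λ a<c → ℕ.≤∧≢⇒< (subst (_≤ toℕ c) (sym b≡) a<c) (≢-sym c≢b)) (ℕ.<-trans a<b) ,
    mk⇔ (λ c<a → ℕ.<-trans c<a a<b) (λ c<b → ℕ.≤∧≢⇒< (ℕ.≤-pred (subst (suc (toℕ c) ≤_) b≡ c<b)) c≢a)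
    where
      a<b : toℕ a < toℕ b
      a<b = subst (toℕ a <_) (sym b≡) (ℕ.n<1+n (toℕ a))

module BlockMap {n : ℕ} (r s : Fin n) where

  InRS : Fin n → Set
  InRS x = inRS r s x ≡ true

  data BlockView : List (Fin n) → Set where
    lastBlock : (u : List (Fin n)) → All InRS u → BlockView u
    block∷    : (u : List (Fin n)) (x : Fin n) (w : List (Fin n)) → All InRS u → inRS r s x ≡ false → BlockView w →
                BlockView (u ++ x ∷ w)

  blockView : (w : List (Fin n)) → BlockView w
  blockView []      = lastBlock [] []
  blockView (x ∷ w) with inRS r s x in x∈ | blockView w
  ... | true  | lastBlock u pu          = lastBlock (x ∷ u) (x∈ ∷ pu)
  ... | true  | block∷ u y w′ pu y∉ v = block∷ (x ∷ u) y w′ (x∈ ∷ pu) y∉ v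
  ... | false | v                       = block∷ [] x w [] x∈ v

  blockMap-lastBlock : (g : List (Fin n) → List (Fin n)) (acc u : List (Fin n)) → All InRS u →
    blockMap r s g acc u ≡ g (acc ++ u)
  blockMap-lastBlock g acc []      []         = cong g (sym (++-identityʳ acc))
  blockMap-lastBlock g acc (x ∷ u) (x∈ ∷ pu) rewrite x∈ =
    trans (blockMap-lastBlock g (acc ++ [ x ]) u pu) (cong g (++-assoc acc [ x ] u))

  blockMap-block∷ : (g : List (Fin n) → List (Fin n)) (acc u : List (Fin n)) (x : Fin n) (w : List (Fin n)) →
    All InRS u → inRS r s x ≡ false → blockMap r s g acc (u ++ x ∷ w) ≡ g (acc ++ u) ++ x ∷ blockMap r s g [] w
  blockMap-block∷ g acc []      x w []         x∉ rewrite x∉ =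
    cong (λ z → g z ++ x ∷ blockMap r s g [] w) (sym (++-identityʳ acc))
  blockMap-block∷ g acc (y ∷ u) x w (y∈ ∷ pu) x∉ rewrite y∈ =
    trans (blockMap-block∷ g (acc ++ [ y ]) u x w pu x∉)
          (cong (λ z → g z ++ x ∷ blockMap r s g [] w) (++-assoc acc [ y ] u))

  -- y′ is the letter found at the position of y once the blocks have been rewritten
  Matching : Fin n → Fin n → Set
  Matching y y′ = (inRS r s y ≡ false × y′ ≡ y) ⊎ (InRS y × InRS y′)

  MatchingHeads : List (Fin n) → List (Fin n) → Set
  MatchingHeads []      []       = ⊤
  MatchingHeads (y ∷ _) (y′ ∷ _) = Matching y y′
  MatchingHeads _       _        = ⊥

  module _ (g : List (Fin n) → List (Fin n)) (g-↭ : (u : List (Fin n)) → g u ↭ u) where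

    blockMap-↭ : (w : List (Fin n)) → blockMap r s g [] w ↭ w
    blockMap-↭ w = go (blockView w)
      where
        go : {w : List (Fin n)} → BlockView w → blockMap r s g [] w ↭ w
        go (lastBlock u pu)        = ↭-trans (↭-reflexive (blockMap-lastBlock g [] u pu)) (g-↭ u)
        go (block∷ u x w pu x∉ v) =
          ↭-trans (↭-reflexive (blockMap-block∷ g [] u x w pu x∉)) (++⁺ (g-↭ u) (prep x (go v)))

    g-InRS : (u : List (Fin n)) → All InRS u → All InRS (g u)
    g-InRS u pu = All-resp-↭ (↭-sym (g-↭ u)) pu

    blockMap-inverse : (g′ : List (Fin n) → List (Fin n)) → ((u : List (Fin n)) → All InRS u → g′ (g u) ≡ u) →
      (w : List (Fin n)) → blockMap r s g′ [] (blockMap r s g [] w) ≡ w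
    blockMap-inverse g′ g′∘g w = go (blockView w)
      where
        go : {w : List (Fin n)} → BlockView w → blockMap r s g′ [] (blockMap r s g [] w) ≡ w
        go (lastBlock u pu) rewrite blockMap-lastBlock g [] u pu =
          trans (blockMap-lastBlock g′ [] (g u) (g-InRS u pu)) (g′∘g u pu)
        go (block∷ u x w pu x∉ v) rewrite blockMap-block∷ g [] u x w pu x∉ =
          trans (blockMap-block∷ g′ [] (g u) x (blockMap r s g [] w) (g-InRS u pu) x∉)
                (cong₂ (λ a b → a ++ x ∷ b) (g′∘g u pu) (go v))

    g-[] : g [] ≡ []
    g-[] = ↭-empty-inv (g-↭ [])

    g-∷ : (a : Fin n) (u : List (Fin n)) → All InRS (a ∷ u) →
      ∃[ b ] ∃[ u′ ] g (a ∷ u) ≡ b ∷ u′ × All InRS (b ∷ u′)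
    g-∷ a u pu with g (a ∷ u) | g-InRS (a ∷ u) pu | ↭-length (g-↭ (a ∷ u))
    ... | b ∷ u′ | pbu | _ = b , u′ , refl , pbu

    g-MatchingHeads : (u : List (Fin n)) → All InRS u → MatchingHeads u (g u)
    g-MatchingHeads []      _  rewrite g-[] = tt
    g-MatchingHeads (a ∷ u) pu@(a∈ ∷ _) with g-∷ a u pu
    ... | b , u′ , g≡ , b∈ ∷ _ rewrite g≡ = inj₂ (a∈ , b∈)

    module AdjBits (R : List Bool → List Bool → Set) (R-refl : ∀ {bs} → R bs bs)
        (R-++ : ∀ {bs bs′ cs cs′} → R bs bs′ → R cs cs′ → R (bs ++ cs) (bs′ ++ cs′))
        (d d′ : Fin n → Fin n → Bool)
        (outside : ∀ x y y′ → inRS r s x ≡ false → Matching y y′ → d x y ≡ d′ x y′ × d y x ≡ d′ y′ x)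
        (inside : (u : List (Fin n)) → All InRS u → R (adjBits d u) (adjBits d′ (g u))) where

      R-∷ : ∀ {b b′ bs bs′} → b ≡ b′ → R bs bs′ → R (b ∷ bs) (b′ ∷ bs′)
      R-∷ {b} refl = R-++ {[ b ]} (R-refl {[ b ]})

      adjBitsFrom-outside : (x : Fin n) → inRS r s x ≡ false → (w w′ : List (Fin n)) → MatchingHeads w w′ →
        R (adjBits d w) (adjBits d′ w′) → R (adjBitsFrom d x w) (adjBitsFrom d′ x w′)
      adjBitsFrom-outside x x∉ []      []        _ _ = R-refl
      adjBitsFrom-outside x x∉ (y ∷ w) (y′ ∷ w′) m h = R-∷ (proj₁ (outside x y y′ x∉ m)) h

      block∷-bits : (u : List (Fin n)) → All InRS u → (x : Fin n) → inRS r s x ≡ false → (w w′ : List (Fin n)) →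
        R (adjBitsFrom d x w) (adjBitsFrom d′ x w′) →
        R (adjBits d (u ++ x ∷ w)) (adjBits d′ (g u ++ x ∷ w′)) × MatchingHeads (u ++ x ∷ w) (g u ++ x ∷ w′)
      block∷-bits []      _  x x∉ w w′ h rewrite g-[] = h , inj₁ (x∉ , refl)
      block∷-bits (a ∷ u) pu@(a∈ ∷ pu₀) x x∉ w w′ h with g-∷ a u pu
      ... | b , u′ , g≡ , b∈ ∷ pu′ rewrite g≡ =
        subst₂ R (sym (adjBitsFrom-++-∷ d a u x w)) (sym (adjBitsFrom-++-∷ d′ b u′ x w′))
          (R-++ (subst (R _) (cong (adjBits d′) g≡) (inside (a ∷ u) pu))
                (R-∷ (proj₂ (outside x _ _ x∉ (inj₂ (lastOf-All u a∈ pu₀ , lastOf-All u′ b∈ pu′)))) h)) ,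
        inj₂ (a∈ , b∈)

      adjBits-blockMap : (w : List (Fin n)) → R (adjBits d w) (adjBits d′ (blockMap r s g [] w))
      adjBits-blockMap w = proj₁ (go (blockView w))
        where
          go : {w : List (Fin n)} → BlockView w →
            R (adjBits d w) (adjBits d′ (blockMap r s g [] w)) × MatchingHeads w (blockMap r s g [] w)
          go (lastBlock u pu) rewrite blockMap-lastBlock g [] u pu = inside u pu , g-MatchingHeads u pu
          go (block∷ u x w pu x∉ v) rewrite blockMap-block∷ g [] u x w pu x∉ with go v
          ... | h , heads = block∷-bits u pu x x∉ w _ (adjBitsFrom-outside x x∉ w _ heads h)

    module _ (nonAdjacent : (j j′ : Fin n) → toℕ j′ ≡ suc (toℕ j) → InRS j → InRS j′ → ⊥) where

      count-∉ : {j : Fin n} → inRS r s j ≡ false → {u : List (Fin n)} → All InRS u → count j u ≡ 0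
      count-∉ j∉ []                   = refl
      count-∉ {j} j∉ {x ∷ u} (x∈ ∷ pu) with j == x in j==x
      ... | true  = contradiction (trans (sym j∉) (trans (cong (inRS r s) (==⇒≡ j==x)) x∈)) λ ()
      ... | false = count-∉ j∉ pu

      -- only one of two adjacent rows j, j′ can lie in {r,s}, so rearranging a block cannot break the
      -- ballot condition between them
      ballot-block : (u u′ : List (Fin n)) → All InRS u → u′ ↭ u → (c : Fin n → ℕ) → Ballot c →
        Ballot (λ j → c j + count j u) → (m : ℕ) → Ballot (λ j → c j + count j (take m u′))
      ballot-block u u′ pu u′↭u c before after m j j′ j′≡
        with inRS r s j in j∈ | inRS r s j′ in j′∈ | All.take⁺ m (All-resp-↭ (↭-sym u′↭u) pu)
      ... | true  | true  | _  = ⊥-elim (nonAdjacent j j′ j′≡ j∈ j′∈)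
      ... | false | false | pt = begin
        c j′ + count j′ (take m u′) ≡⟨ cong (c j′ +_) (count-∉ j′∈ pt) ⟩
        c j′ + 0                    ≤⟨ ℕ.+-monoˡ-≤ 0 (before j j′ j′≡) ⟩
        c j + 0                     ≡⟨ cong (c j +_) (count-∉ j∈ pt) ⟨
        c j + count j (take m u′)   ∎
        where open ℕ.≤-Reasoning
      ... | false | true  | pt = begin
        c j′ + count j′ (take m u′) ≤⟨ ℕ.+-monoʳ-≤ (c j′) (count-take-≤ j′ m u′) ⟩
        c j′ + count j′ u′          ≡⟨ cong (c j′ +_) (count-↭ j′ u′↭u) ⟩
        c j′ + count j′ u           ≤⟨ after j j′ j′≡ ⟩
        c j + count j u             ≡⟨ cong (c j +_) (trans (count-∉ j∈ pu) (sym (count-∉ j∈ pt))) ⟩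
        c j + count j (take m u′)   ∎
        where open ℕ.≤-Reasoning
      ... | true  | false | pt = begin
        c j′ + count j′ (take m u′) ≡⟨ trans (cong (c j′ +_) (count-∉ j′∈ pt)) (ℕ.+-identityʳ (c j′)) ⟩
        c j′                        ≤⟨ before j j′ j′≡ ⟩
        c j                         ≤⟨ ℕ.m≤m+n (c j) _ ⟩
        c j + count j (take m u′)   ∎
        where open ℕ.≤-Reasoning

      ballot-blockMap : {w : List (Fin n)} → BlockView w → (c : Fin n → ℕ) →
        ((m : ℕ) → Ballot (λ j → c j + count j (take m w))) →
        (m : ℕ) → Ballot (λ j → c j + count j (take m (blockMap r s g [] w)))
      ballot-blockMap (lastBlock u pu) c ballot m rewrite blockMap-lastBlock g [] u pu =
        ballot-block u (g u) pu (g-↭ u) c (Ballot-resp (λ j → ℕ.+-identityʳ (c j)) (ballot 0))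
          (Ballot-resp (λ j → cong (λ z → c j + count j z) (take-all (length u) u ℕ.≤-refl)) (ballot (length u)))
          m
      ballot-blockMap (block∷ u x w pu x∉ v) c ballot m rewrite blockMap-block∷ g [] u x w pu x∉
        with ≤⊎≡+suc m (length u)
      ... | inj₁ m≤ =
        Ballot-resp (λ j → cong (λ z → c j + count j z) (sym (take-++-≤ m (g u) (subst (m ≤_) (sym |gu|) m≤))))
          (ballot-block u (g u) pu (g-↭ u) c (Ballot-resp (λ j → ℕ.+-identityʳ (c j)) (ballot 0))
            (Ballot-resp (λ j → cong (λ z → c j + count j z) (take-length-++ u (x ∷ w))) (ballot (length u))) m)
        where |gu| = ↭-length (g-↭ u)
      ... | inj₂ (m′ , refl) = Ballot-resp shift (ballot-blockMap v c′ ballot′ m′)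
        where
          c′ : Fin n → ℕ
          c′ j = c j + count j (u ++ [ x ])
          ballot′ : (m : ℕ) → Ballot (λ j → c′ j + count j (take m w))
          ballot′ m = Ballot-resp
            (λ j → trans (cong (c j +_) (count-take-length-++-∷ j u x w m)) (sym (ℕ.+-assoc (c j) _ _)))
            (ballot (length u + suc m))
          W : List (Fin n)
          W = blockMap r s g [] w
          shift : (j : Fin n) →
            c′ j + count j (take m′ W) ≡ c j + count j (take (length u + suc m′) (g u ++ x ∷ W))
          shift j = begin
            c j + count j (u ++ [ x ]) + count j (take m′ W)
              ≡⟨ ℕ.+-assoc (c j) _ _ ⟩
            c j + (count j (u ++ [ x ]) + count j (take m′ W))
              ≡⟨ cong (λ z → c j + (z + count j (take m′ W))) (count-↭ j (++⁺ʳ [ x ] (g-↭ u))) ⟨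
            c j + (count j (g u ++ [ x ]) + count j (take m′ W))
              ≡⟨ cong (c j +_) (count-take-length-++-∷ j (g u) x W m′) ⟨
            c j + count j (take (length (g u) + suc m′) (g u ++ x ∷ W))
              ≡⟨ cong (λ k → c j + count j (take (k + suc m′) (g u ++ x ∷ W))) (↭-length (g-↭ u)) ⟩
            c j + count j (take (length u + suc m′) (g u ++ x ∷ W)) ∎
            where open ≡-Reasoning

      blockMap-IsTabWord : (k : ℕ) (w : List (Fin n)) → IsTabWord n k w → IsTabWord n k (blockMap r s g [] w)
      blockMap-IsTabWord k w (counts , ballot) =
        (λ j → trans (count-↭ j (blockMap-↭ w)) (counts j)) ,
        ballot-blockMap (blockView w) (λ _ → 0) ballot

module Exchange {n : ℕ} (σ τ : Permutation′ n) {r s : Fin n} {ℓ : ℕ}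
    (σr : toℕ (σ ⟨$⟩ʳ r) ≡ ℓ) (σs : toℕ (σ ⟨$⟩ʳ s) ≡ suc ℓ)
    (τr : τ ⟨$⟩ʳ r ≡ σ ⟨$⟩ʳ s) (τs : τ ⟨$⟩ʳ s ≡ σ ⟨$⟩ʳ r)
    (τ-other : (i : Fin n) → i ≢ r → i ≢ s → τ ⟨$⟩ʳ i ≡ σ ⟨$⟩ʳ i) where

  open BlockMap r s

  dσ dτ : Fin n → Fin n → Bool
  dσ = descent (σ ⟨$⟩ʳ_)
  dτ = descent (τ ⟨$⟩ʳ_)

  σs≡1+σr : toℕ (σ ⟨$⟩ʳ s) ≡ suc (toℕ (σ ⟨$⟩ʳ r))
  σs≡1+σr = trans σs (cong suc (sym σr))

  r≢s : r ≢ s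
  r≢s refl = ℕ.1+n≢n (sym σs≡1+σr)

  σr<σs : σ ⟨$⟩ʳ r <ᶠ σ ⟨$⟩ʳ s
  σr<σs = subst (λ t → suc (toℕ (σ ⟨$⟩ʳ r)) ≤ t) (sym σs≡1+σr) ℕ.≤-refl

  σs≮σr : ¬ (σ ⟨$⟩ʳ s <ᶠ σ ⟨$⟩ʳ r)
  σs≮σr = ℕ.<-asym σr<σs

  dσ-refl : (x : Fin n) → dσ x x ≡ false
  dσ-refl = descent-irrefl (σ ⟨$⟩ʳ_)

  dτ-refl : (x : Fin n) → dτ x x ≡ false
  dτ-refl = descent-irrefl (τ ⟨$⟩ʳ_)

  dσ-rs : dσ r s ≡ false
  dσ-rs = isYes-false _ σs≮σr

  dσ-sr : dσ s r ≡ true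
  dσ-sr = isYes-true _ σr<σs

  dτ-rs : dτ r s ≡ true
  dτ-rs rewrite τr | τs = isYes-true _ σr<σs

  dτ-sr : dτ s r ≡ false
  dτ-sr rewrite τr | τs = isYes-false _ σs≮σr

  σ-injective : {x y : Fin n} → σ ⟨$⟩ʳ x ≡ σ ⟨$⟩ʳ y → x ≡ y
  σ-injective eq = trans (sym (inverseˡ σ)) (trans (cong (σ ⟨$⟩ˡ_) eq) (inverseˡ σ))

  SwappedValue : Fin n → Set
  SwappedValue z = z ≡ σ ⟨$⟩ʳ r ⊎ z ≡ σ ⟨$⟩ʳ s

  σ-swapped : {y : Fin n} → InRS y → SwappedValue (σ ⟨$⟩ʳ y)
  σ-swapped {y} y∈ with inRS⇒OneOf {r = r} {s = s} {x = y} y∈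
  ... | inj₁ refl = inj₁ refl
  ... | inj₂ refl = inj₂ refl

  τ-swapped : {y : Fin n} → InRS y → SwappedValue (τ ⟨$⟩ʳ y)
  τ-swapped {y} y∈ with inRS⇒OneOf {r = r} {s = s} {x = y} y∈
  ... | inj₁ refl = inj₂ τr
  ... | inj₂ refl = inj₁ τs

  outside : (x y y′ : Fin n) → inRS r s x ≡ false → Matching y y′ → dσ x y ≡ dτ x y′ × dσ y x ≡ dτ y′ x
  outside x y y′ x∉ (inj₁ (y∉ , refl))
    rewrite τ-other x (proj₁ (inRS-false x∉)) (proj₂ (inRS-false x∉))
          | τ-other y (proj₁ (inRS-false y∉)) (proj₂ (inRS-false y∉)) = refl , refl
  outside x y y′ x∉ (inj₂ (y∈ , y′∈)) rewrite τ-other x (proj₁ (inRS-false x∉)) (proj₂ (inRS-false x∉)) =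
    trans (below (σ-swapped y∈)) (sym (below (τ-swapped y′∈))) ,
    trans (above (σ-swapped y∈)) (sym (above (τ-swapped y′∈)))
    where
      c : Fin n
      c = σ ⟨$⟩ʳ x
      c≢σr : toℕ c ≢ toℕ (σ ⟨$⟩ʳ r)
      c≢σr eq = proj₁ (inRS-false x∉) (σ-injective (toℕ-injective eq))
      c≢σs : toℕ c ≢ toℕ (σ ⟨$⟩ʳ s)
      c≢σs eq = proj₂ (inRS-false x∉) (σ-injective (toℕ-injective eq))
      below : {z : Fin n} → SwappedValue z → isYes (z <? c) ≡ isYes (σ ⟨$⟩ʳ r <? c)
      below (inj₁ refl) = refl
      below (inj₂ refl) = sym (isYes-⇔ (proj₁ (consecutive-< σs≡1+σr c≢σr c≢σs)) _ _)
      above : {z : Fin n} → SwappedValue z → isYes (c <? z) ≡ isYes (c <? σ ⟨$⟩ʳ r)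
      above (inj₁ refl) = refl
      above (inj₂ refl) = sym (isYes-⇔ (proj₂ (consecutive-< σs≡1+σr c≢σr c≢σs)) _ _)

  outside-== : (x y y′ : Fin n) → inRS r s x ≡ false → Matching y y′ →
    (x == y) ≡ (x == y′) × (y == x) ≡ (y′ == x)
  outside-== x y y′ x∉ (inj₁ (_ , refl))    = refl , refl
  outside-== x y y′ x∉ (inj₂ (y∈ , y′∈)) =
    trans (==-≢ (x≢ y∈)) (sym (==-≢ (x≢ y′∈))) ,
    trans (==-≢ (≢-sym (x≢ y∈))) (sym (==-≢ (≢-sym (x≢ y′∈))))
    where
      x≢ : {z : Fin n} → InRS z → x ≢ z
      x≢ z∈ refl = contradiction (trans (sym x∉) z∈) λ ()

  letters : {u : List (Fin n)} → All InRS u → All (OneOf r s) u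
  letters = mapAll (inRS⇒OneOf {r = r} {s = s})

  ι : Fin n → ℕ
  ι z = if z == r then 1 else 0

  -- inside a {r,s}-word the σ-descents are its steps s → r and the τ-descents its steps r → s
  trues-dτ-dσ : (h : Fin n) (w : List (Fin n)) → All (OneOf r s) (h ∷ w) →
    trues (adjBitsFrom dτ h w) + ι (lastOf h w) ≡ trues (adjBitsFrom dσ h w) + ι h
  trues-dτ-dσ h []      _ = refl
  trues-dτ-dσ h (y ∷ w) (ph ∷ py ∷ pw) with trues-dτ-dσ y w (py ∷ pw)
  trues-dτ-dσ h (y ∷ w) (inj₁ refl ∷ inj₁ refl ∷ _) | ih rewrite dσ-refl r | dτ-refl r = ih
  trues-dτ-dσ h (y ∷ w) (inj₂ refl ∷ inj₂ refl ∷ _) | ih rewrite dσ-refl s | dτ-refl s = ih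
  trues-dτ-dσ h (y ∷ w) (inj₁ refl ∷ inj₂ refl ∷ _) | ih rewrite dσ-rs | dτ-rs | ==-refl r | ==-≢ (≢-sym r≢s) =
    trans (cong suc ih) (sym (ℕ.+-suc (trues (adjBitsFrom dσ s w)) 0))
  trues-dτ-dσ h (y ∷ w) (inj₂ refl ∷ inj₁ refl ∷ _) | ih rewrite dσ-sr | dτ-sr | ==-refl r | ==-≢ (≢-sym r≢s) =
    trans ih (ℕ.+-suc (trues (adjBitsFrom dσ r w)) 0)

  dσrs≡dτsr : dσ r s ≡ dτ s r
  dσrs≡dτsr = trans dσ-rs (sym dτ-sr)

  dσsr≡dτrs : dσ s r ≡ dτ r s
  dσsr≡dτrs = trans dσ-sr (sym dτ-rs)

  ==rs≡==sr : (r == s) ≡ (s == r)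
  ==rs≡==sr = trans (==-≢ r≢s) (sym (==-≢ (≢-sym r≢s)))

  module DesRunsRS = SwapRunsBits.Count dσ dτ r≢s false
                       (dσ-refl r) (dσ-refl s) (dτ-refl r) (dτ-refl s) dσrs≡dτsr dσsr≡dτrs
  module DesRunsSR = SwapRunsBits.Count dσ dτ (≢-sym r≢s) false
                       (dσ-refl s) (dσ-refl r) (dτ-refl s) (dτ-refl r) dσsr≡dτrs dσrs≡dτsr
  module PlatRunsRS = SwapRunsBits.Count _==_ _==_ r≢s true
                        (==-refl r) (==-refl s) (==-refl r) (==-refl s) ==rs≡==sr (sym ==rs≡==sr)
  module PlatRunsSR = SwapRunsBits.Count _==_ _==_ (≢-sym r≢s) true
                        (==-refl s) (==-refl r) (==-refl s) (==-refl r) (sym ==rs≡==sr) ==rs≡==sr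
  module DesRunPositions = SwapRunsBits.Positions dσ dτ r≢s
                             (dσ-refl r) dσ-rs (dσ-refl s) (dτ-refl s) dτ-sr (dτ-refl r) dσsr≡dτrs

  des-block : (u : List (Fin n)) → All InRS u → trues (adjBits dσ u) ≡ trues (adjBits dτ (fBlock u))
  des-block []      _  = refl
  des-block (h ∷ w) pu with h == lastOf h w in ends
  ... | true  = sym (ℕ.+-cancelʳ-≡ (ι h) _ _
                  (trans (cong (λ z → trues (adjBitsFrom dτ h w) + ι z) (==⇒≡ ends))
                         (trues-dτ-dσ h w (letters pu))))
  ... | false with distinctEnds⇒alternating r≢s h w (letters pu) ends
  ...   | inj₁ alt = DesRunsRS.trues-adjBits-swapRuns alt
  ...   | inj₂ alt = DesRunsSR.trues-adjBits-swapRuns alt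

  plat-block : (u : List (Fin n)) → All InRS u → trues (adjBits _==_ u) ≡ trues (adjBits _==_ (fBlock u))
  plat-block []      _  = refl
  plat-block (h ∷ w) pu with h == lastOf h w in ends
  ... | true  = refl
  ... | false with distinctEnds⇒alternating r≢s h w (letters pu) ends
  ...   | inj₁ alt = PlatRunsRS.trues-adjBits-swapRuns alt
  ...   | inj₂ alt = PlatRunsSR.trues-adjBits-swapRuns alt

  adjBits-swapCut : (p q p′ q′ : List (Fin n)) → length p ≡ length p′ → length q ≡ length q′ →
    Alternating r s (q ++ p) → Alternating s r (q′ ++ p′) →
    adjBits dσ (q ++ p) ≡ adjBits dτ (q′ ++ p′) → adjBits dσ (p ++ q) ≡ adjBits dτ (p′ ++ q′)
  adjBits-swapCut []      q       []        q′       _ _ _ _ eq =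
    subst₂ (λ a b → adjBits dσ a ≡ adjBits dτ b) (++-identityʳ q) (++-identityʳ q′) eq
  adjBits-swapCut (a ∷ p) []      (a′ ∷ p′) []       _ _ _ _ eq =
    subst₂ (λ a b → adjBits dσ a ≡ adjBits dτ b) (sym (++-identityʳ (a ∷ p))) (sym (++-identityʳ (a′ ∷ p′)))
      eq
  adjBits-swapCut (a ∷ p) (b ∷ q) (a′ ∷ p′) (b′ ∷ q′) _ |q|≡ alt alt′ eq
    with alternating-ends alt | alternating-ends alt′
  ... | _ , refl , last≡ | _ , refl , last′≡ =
    adjBits-swapHalves dσ dτ a p r q a′ p′ s q′ (ℕ.suc-injective |q|≡) junction eq
    where
      junction : dσ (lastOf a p) r ≡ dτ (lastOf a′ p′) s
      junction = subst₂ (λ z z′ → dσ z r ≡ dτ z′ s)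
                   (trans (sym last≡) (lastOf-++-∷ r q a p)) (trans (sym last′≡) (lastOf-++-∷ s q′ a′ p′))
                   dσsr≡dτrs
  adjBits-swapCut []      _       (_ ∷ _)   _        () _ _ _ _
  adjBits-swapCut (_ ∷ _) _       []        _        () _ _ _ _
  adjBits-swapCut (_ ∷ _) []      (_ ∷ _)   (_ ∷ _) _ () _ _ _
  adjBits-swapCut (_ ∷ _) (_ ∷ _) (_ ∷ _)   []       _ () _ _ _

  adjBits-cyclicSwap : {u p q : List (Fin n)} → CyclicCut r s u p q → adjBits dσ u ≡ adjBits dτ (cyclicSwap p q)
  adjBits-cyclicSwap {p = p} {q} (refl , q≢[] , alt) with cyclicSwap-cut r≢s q≢[] alt
  ... | p′ , q′ , (cs≡ , _ , alt′) , |p′| , |q′| , q′p′≡ =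
    trans (adjBits-swapCut p q p′ q′ (sym |p′|) (sym |q′|) alt alt′ whole) (cong (adjBits dτ) (sym cs≡))
    where
      whole : adjBits dσ (q ++ p) ≡ adjBits dτ (q′ ++ p′)
      whole = trans (DesRunPositions.adjBits-swapRuns alt) (cong (adjBits dτ) (sym q′p′≡))

  Des-block : (u : List (Fin n)) → All InRS u → adjBits dσ u ≡ adjBits dτ (FBlock r s u)
  Des-block u pu with FBlock-cases r≢s u (letters pu)
  ... | inj₁ (const , eq) rewrite eq = constant-adjBits u const
    where
      constant-adjBits : (u : List (Fin n)) → Constant u → adjBits dσ u ≡ adjBits dτ u
      constant-adjBits []      _     = refl
      constant-adjBits (h ∷ w) const =
        adjBitsFrom-constant dσ dτ h w const (trans (dσ-refl h) (sym (dτ-refl h)))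
  ... | inj₂ (p , q , cut , eq) rewrite eq = adjBits-cyclicSwap cut

  module TrueCounts = AdjBits fBlock fBlock-↭ (λ bs bs′ → trues bs ≡ trues bs′) refl
                              (λ {bs} {bs′} {cs} {cs′} → trues-++-cong {bs} {bs′} {cs} {cs′})
  module DesCount   = TrueCounts dσ dτ outside des-block
  module PlatCount  = TrueCounts _==_ _==_ outside-== plat-block
  module DesBits    = AdjBits (FBlock r s) (FBlock-↭ r s) _≡_ refl (cong₂ _++_) dσ dτ outside Des-block

  des-f : (T : List (Fin n)) → des (σ ⟨$⟩ʳ_) T ≡ des (τ ⟨$⟩ʳ_) (f r s T)
  des-f T =
    trans (des≡trues (σ ⟨$⟩ʳ_) T) (trans (DesCount.adjBits-blockMap T) (sym (des≡trues (τ ⟨$⟩ʳ_) (f r s T))))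

  plat-f : (T : List (Fin n)) → plat T ≡ plat (f r s T)
  plat-f T = trans (plat≡trues T) (trans (PlatCount.adjBits-blockMap T) (sym (plat≡trues (f r s T))))

  Des-F : (T : List (Fin n)) → Des (σ ⟨$⟩ʳ_) T ≡ Des (τ ⟨$⟩ʳ_) (F r s T)
  Des-F T = trans (desPos≡truePositions _ 1 T)
              (trans (cong (truePositions 1) (DesBits.adjBits-blockMap T)) (sym (desPos≡truePositions _ 1 (F r s T))))

inverses⇒IsSYTBijection : {n k : ℕ} (φ ψ : List (Fin n) → List (Fin n)) →
  ((w : List (Fin n)) → IsTabWord n k w → IsTabWord n k (φ w)) →
  ((w : List (Fin n)) → IsTabWord n k w → IsTabWord n k (ψ w)) →
  ((w : List (Fin n)) → ψ (φ w) ≡ w) → ((w : List (Fin n)) → φ (ψ w) ≡ w) → IsSYTBijection n k φ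
inverses⇒IsSYTBijection φ ψ φ-tab ψ-tab ψ∘φ φ∘ψ =
  φ-tab ,
  (λ w v _ _ φw≡φv → trans (sym (ψ∘φ w)) (trans (cong ψ φw≡φv) (ψ∘φ v))) ,
  (λ v v-tab → ψ v , ψ-tab v v-tab , φ∘ψ v)

module Bijections {n : ℕ} {r s : Fin n} (r≁s : 1 < ∣ toℕ r - toℕ s ∣) where

  r≢s : r ≢ s
  r≢s refl = contradiction (subst (1 <_) (ℕ.∣n-n∣≡0 (toℕ r)) r≁s) λ ()

  s≁r : 1 < ∣ toℕ s - toℕ r ∣
  s≁r = subst (1 <_) (ℕ.∣-∣-comm (toℕ r) (toℕ s)) r≁s

  f-involutive : (w : List (Fin n)) → f r s (f r s w) ≡ w
  f-involutive = BlockMap.blockMap-inverse r s fBlock fBlock-↭ fBlock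
                   (λ u pu → fBlock-involutive r≢s u (mapAll inRS⇒OneOf pu))

  Fsr∘Frs≡id : (w : List (Fin n)) → F s r (F r s w) ≡ w
  Fsr∘Frs≡id w = trans (blockMap-comm r s (FBlock s r) [] (F r s w))
    (BlockMap.blockMap-inverse r s (FBlock r s) (FBlock-↭ r s) (FBlock s r)
      (λ u pu → FBlock-involutive r≢s u (mapAll inRS⇒OneOf pu)) w)

  Frs∘Fsr≡id : (w : List (Fin n)) → F r s (F s r w) ≡ w
  Frs∘Fsr≡id w = trans (sym (blockMap-comm r s (FBlock r s) [] (F s r w)))
    (BlockMap.blockMap-inverse s r (FBlock s r) (FBlock-↭ s r) (FBlock r s)
      (λ u pu → FBlock-involutive (≢-sym r≢s) u (mapAll inRS⇒OneOf pu)) w)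

  f-IsSYTBijection : (k : ℕ) → IsSYTBijection n k (f r s)
  f-IsSYTBijection k = inverses⇒IsSYTBijection (f r s) (f r s) f-IsTabWord f-IsTabWord f-involutive f-involutive
    where
      f-IsTabWord : (w : List (Fin n)) → IsTabWord n k w → IsTabWord n k (f r s w)
      f-IsTabWord = BlockMap.blockMap-IsTabWord r s fBlock fBlock-↭ (nonAdjacent r s r≁s) k

  F-IsSYTBijection : (k : ℕ) → IsSYTBijection n k (F r s)
  F-IsSYTBijection k = inverses⇒IsSYTBijection (F r s) (F s r)
    (BlockMap.blockMap-IsTabWord r s (FBlock r s) (FBlock-↭ r s) (nonAdjacent r s r≁s) k)
    (BlockMap.blockMap-IsTabWord s r (FBlock s r) (FBlock-↭ s r) (nonAdjacent s r s≁r) k)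
    Fsr∘Frs≡id Frs∘Fsr≡id

lemma4p3 : (n k : ℕ) → 1 ≤ n → 1 ≤ k →
    (σ τ : Permutation′ n) (r s : Fin n) → 1 < ∣ toℕ r - toℕ s ∣ →
    (ℓ : ℕ) → toℕ (σ ⟨$⟩ʳ r) ≡ ℓ → toℕ (σ ⟨$⟩ʳ s) ≡ suc ℓ →
    τ ⟨$⟩ʳ r ≡ σ ⟨$⟩ʳ s → τ ⟨$⟩ʳ s ≡ σ ⟨$⟩ʳ r →
    ((i : Fin n) → i ≢ r → i ≢ s → τ ⟨$⟩ʳ i ≡ σ ⟨$⟩ʳ i) →
    IsSYTBijection n k (f r s) × IsSYTBijection n k (F r s) ×
    ((T : List (Fin n)) → IsTabWord n k T →
       des (σ ⟨$⟩ʳ_) T ≡ des (τ ⟨$⟩ʳ_) (f r s T) ×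
       plat T ≡ plat (f r s T) ×
       Des (σ ⟨$⟩ʳ_) T ≡ Des (τ ⟨$⟩ʳ_) (F r s T))
lemma4p3 n k _ _ σ τ r s r≁s ℓ σr σs τr τs τ-other =
  f-IsSYTBijection k , F-IsSYTBijection k , λ T _ → des-f T , plat-f T , Des-F T
  where
    open Bijections {r = r} {s = s} r≁s
    open Exchange σ τ σr σs τr τs τ-other
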